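{- Let $m\geq 2$ and consider the group $U_{6m}$. Then $\mathrm{Spec}(\Gamma_{U_{6m}})=\{[0]^{2m-2},[m]^1,[-m]^1\}$, $\mathrm{L\text{ - }Spec}(\Gamma_{U_{6m}})=\mathrm{Q\text{ - }Spec}(\Gamma_{U_{6m}})=\{[0]^1,[m]^{2m-2},[2m]^1\}$, and $E(\Gamma_{U_{6m}})=LE(\Gamma_{U_{6m}})=SE(\Gamma_{U_{6m}})=2m$.
   Context: $U_{6m}=\langle x,y\mid x^{2m}=y^3=1,\ x^{ -1}yx=y^{ -1}\rangle$. For a finite non-abelian group $G$ with center $Z(G)$, the NCCC-graph $\Gamma_G$ is the simple undirected graph whose vertices are the conjugacy classes $x^G$ of the elements $x\in G\setminus Z(G)$, two distinct vertices $x^G,y^G$ being adjacent iff $x'y'\neq y'x'$ for all $x'\in x^G$, $y'\in y^G$. For a simple graph with adjacency matrix $A$ and degree matrix $D$, $L=D-A$, $Q=D+A$; $\mathrm{Spec},\mathrm{L\text{ - }Spec},\mathrm{Q\text{ - }Spec}$ are the multisets of eigenvalues of $A,L,Q$, written $\{[\lambda]^{k},\dots\}$ with $k$ the multiplicity. With $\Delta=2|e|/|v|$ (twice the number of edges over the number of vertices), $E=\sum_{\mathrm{Spec}}|\alpha|$, $LE=\sum_{\mathrm{L\text{ - }Spec}}|\beta-\Delta|$, $SE=\sum_{\mathrm{Q\text{ - }Spec}}|\gamma-\Delta|$. -}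

module Defs where

open import Data.Nat as ℕ using (ℕ; zero; suc)
open import Data.Nat.DivMod using (_mod_)
open import Data.Fin using (Fin; zero; suc; toℕ; punchIn)
open import Data.Product using (Σ; _×_; _,_)
open import Data.List using (List; []; _∷_; _++_; replicate; map; foldr)
open import Data.Integer using (+_; -[1+_])
open import Data.Rational using (ℚ; 0ℚ; 1ℚ; _+_; _*_; _-_; -_; ∣_∣; _/_)
open import Relation.Binary.PropositionalEquality using (_≡_; _≢_)
open import Relation.Nullary using (¬_)

-- The group U_{6m} = < x, y | x^{2m} = y^3 = 1, x^{-1} y x = y^{-1} >.
-- Concrete normal-form model: the pair (a , b) stands for x^a y^b with
-- a ∈ Z/2m, b ∈ Z/3.  From y^b x^c = x^c y^((-1)^c b) one gets
--   x^a y^b · x^c y^d = x^(a+c) y^((-1)^c b + d).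

addMod : {n : ℕ} → Fin n → Fin n → Fin n
addMod {suc n} a b = (toℕ a ℕ.+ toℕ b) mod (suc n)

negMod : {n : ℕ} → Fin n → Fin n
negMod {suc n} a = (suc n ℕ.∸ toℕ a) mod (suc n)

-- (-1)^c · b in Z/3, c read as a natural number (well defined mod 2m)
signAct : ℕ → Fin 3 → Fin 3
signAct zero          b = b
signAct (suc zero)    b = negMod b
signAct (suc (suc c)) b = signAct c b

U : ℕ → Set
U m = Fin (2 ℕ.* m) × Fin 3

mulU : (m : ℕ) → U m → U m → U m
mulU m (a , b) (c , d) = addMod a c , addMod (signAct (toℕ c) b) d

Central : (m : ℕ) → U m → Set
Central m g = (h : U m) → mulU m g h ≡ mulU m h g

-- g and h are conjugate: z g z⁻¹ = h, i.e. z g = h z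
Conj : (m : ℕ) → U m → U m → Set
Conj m g h = Σ (U m) λ z → mulU m z g ≡ mulU m h z

-- reps enumerates the conjugacy classes of non-central elements,
-- one representative per class (vertices of the NCCC-graph).
IsClassEnumeration : (m k : ℕ) → (Fin k → U m) → Set
IsClassEnumeration m k reps =
  ((i : Fin k) → ¬ Central m (reps i)) ×
  (((g : U m) → ¬ Central m g → Σ (Fin k) λ i → Conj m g (reps i)) ×
   ((i j : Fin k) → Conj m (reps i) (reps j) → i ≡ j))

NCCCAdj : (m k : ℕ) → (Fin k → U m) → Fin k → Fin k → Set
NCCCAdj m k reps i j =
  i ≢ j ×
  ((g h : U m) → Conj m g (reps i) → Conj m h (reps j) →
    mulU m g h ≢ mulU m h g)

Matrix : ℕ → Set
Matrix k = Fin k → Fin k → ℚ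

IsAdjacencyMatrix : {k : ℕ} → (Fin k → Fin k → Set) → Matrix k → Set
IsAdjacencyMatrix {k} Adj A =
  (i j : Fin k) → (Adj i j → A i j ≡ 1ℚ) × (¬ Adj i j → A i j ≡ 0ℚ)

sumFin : {k : ℕ} → (Fin k → ℚ) → ℚ
sumFin {zero}  f = 0ℚ
sumFin {suc k} f = f zero + sumFin (λ i → f (suc i))

sumList : List ℚ → ℚ
sumList = foldr _+_ 0ℚ

prodList : List ℚ → ℚ
prodList = foldr _*_ 1ℚ

sgn : {n : ℕ} → Fin n → ℚ
sgn zero          = 1ℚ
sgn (suc zero)    = - 1ℚ
sgn (suc (suc i)) = sgn i

det : {k : ℕ} → Matrix k → ℚ
det {zero}  M = 1ℚ
det {suc k} M =
  sumFin (λ j → sgn j * (M zero j * det (λ r c → M (suc r) (punchIn j c))))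

δ : {k : ℕ} → Fin k → Fin k → ℚ
δ zero    zero    = 1ℚ
δ zero    (suc j) = 0ℚ
δ (suc i) zero    = 0ℚ
δ (suc i) (suc j) = δ i j

degree : {k : ℕ} → Matrix k → Fin k → ℚ
degree A i = sumFin (λ j → A i j)

degreeMatrix : {k : ℕ} → Matrix k → Matrix k
degreeMatrix A i j = δ i j * degree A i

laplacian : {k : ℕ} → Matrix k → Matrix k
laplacian A i j = degreeMatrix A i j - A i j

signlessLaplacian : {k : ℕ} → Matrix k → Matrix k
signlessLaplacian A i j = degreeMatrix A i j + A i j

-- Δ = 2|e|/|v| = (sum of degrees)/(number of vertices)
avgDegree : {k : ℕ} → Matrix k → ℚ
avgDegree {zero}  A = 0ℚ
avgDegree {suc k} A = sumFin (degree A) * ((+ 1) / suc k)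

-- μs is the spectrum (multiset of eigenvalues with algebraic
-- multiplicity) of M: det(t I - M) = ∏ (t - μ) as polynomials in t
-- (equivalently as functions on the infinite field ℚ).
HasSpectrum : {k : ℕ} → Matrix k → List ℚ → Set
HasSpectrum M μs =
  (t : ℚ) → det (λ i j → t * δ i j - M i j) ≡ prodList (map (λ μ → t - μ) μs)

shiftedAbsSum : ℚ → List ℚ → ℚ
shiftedAbsSum c μs = sumList (map (λ μ → ∣ μ - c ∣) μs)

SpectralSumIs : {k : ℕ} → Matrix k → ℚ → ℚ → Set
SpectralSumIs M c e = (μs : List ℚ) → HasSpectrum M μs → shiftedAbsSum c μs ≡ e

EnergyIs : {k : ℕ} → Matrix k → ℚ → Set
EnergyIs A e = SpectralSumIs A 0ℚ e

LaplacianEnergyIs : {k : ℕ} → Matrix k → ℚ → Set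
LaplacianEnergyIs A e = SpectralSumIs (laplacian A) (avgDegree A) e

SignlessLaplacianEnergyIs : {k : ℕ} → Matrix k → ℚ → Set
SignlessLaplacianEnergyIs A e = SpectralSumIs (signlessLaplacian A) (avgDegree A) e

ℕ→ℚ : ℕ → ℚ
ℕ→ℚ n = (+ n) / 1

-- The non-central elements x^a y^b of U_{6m} (those with a odd or b ≠ 0) form one
-- conjugacy class for each exponent a ∈ ℤ/2m, since conjugation fixes a and all
-- non-central elements with the same a are conjugate; and two classes contain commuting
-- elements exactly when their exponents have the same parity. So Γ is the complete
-- bipartite graph K_{m,m}. Expanding det (x I - α B) along its first row gives
-- x^(n-2) (x² - α² p q) for K_{p,q} on n vertices; the graph is m-regular, so
-- t I - L and t I - Q are (t - m) I ± B and all three spectra follow. Finally, a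
-- characteristic polynomial determines its roots up to permutation, so the energies
-- can be computed from the listed spectra.
module Submission where

open import Defs
open import Data.Nat as ℕ using (ℕ; suc)
open import Data.Fin using (Fin)
open import Data.Parity.Base using (Parity)
open import Relation.Binary.PropositionalEquality using (_≡_)

module RationalFacts where
  open import Data.Nat as ℕ using (ℕ; zero; suc)
  open import Data.Nat.Coprimality as Coprime using (Coprime)
  open import Data.Nat.Divisibility using (∣1⇒≡1)
  import Data.Integer as ℤ
  import Data.Integer.Properties as ℤ
  open import Data.Product using (proj₂)
  open import Data.Sum using (_⊎_; inj₁; inj₂; [_,_]′)
  open import Function using (id)
  open import Data.Rational
  open import Data.Rational.Properties
  open import Relation.Binary.PropositionalEquality
  open import Relation.Nullary using (yes; no)

  coprimeTo1 : ∀ n → Coprime n 1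
  coprimeTo1 n p = ∣1⇒≡1 (proj₂ p)

  ℕ→ℚ≡mkℚ : ∀ n → ℕ→ℚ n ≡ mkℚ (ℤ.+ n) 0 (coprimeTo1 n)
  ℕ→ℚ≡mkℚ n = normalize-coprime (coprimeTo1 n)

  ℕ→ℚ-injective : ∀ {m n} → ℕ→ℚ m ≡ ℕ→ℚ n → m ≡ n
  ℕ→ℚ-injective {m} {n} eq =
    ℤ.+-injective (cong ↥_ (trans (sym (ℕ→ℚ≡mkℚ m)) (trans eq (ℕ→ℚ≡mkℚ n))))

  ℕ→ℚ-suc : ∀ n → ℕ→ℚ (suc n) ≡ 1ℚ + ℕ→ℚ n
  ℕ→ℚ-suc n = begin
    ℤ.+ suc n / 1                      ≡⟨ cong (λ i → (ℤ.+ 1 ℤ.+ i) / 1) (sym (ℤ.*-identityʳ (ℤ.+ n))) ⟩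
    1ℚ + mkℚ (ℤ.+ n) 0 (coprimeTo1 n)  ≡⟨ cong (1ℚ +_) (sym (ℕ→ℚ≡mkℚ n)) ⟩
    1ℚ + ℕ→ℚ n                         ∎
    where open ≡-Reasoning

  ℕ→ℚ-+ : ∀ m n → ℕ→ℚ (m ℕ.+ n) ≡ ℕ→ℚ m + ℕ→ℚ n
  ℕ→ℚ-+ zero    n = sym (+-identityˡ (ℕ→ℚ n))
  ℕ→ℚ-+ (suc m) n = begin
    ℕ→ℚ (suc (m ℕ.+ n))        ≡⟨ ℕ→ℚ-suc (m ℕ.+ n) ⟩
    1ℚ + ℕ→ℚ (m ℕ.+ n)         ≡⟨ cong (1ℚ +_) (ℕ→ℚ-+ m n) ⟩
    1ℚ + (ℕ→ℚ m + ℕ→ℚ n)       ≡⟨ sym (+-assoc 1ℚ (ℕ→ℚ m) (ℕ→ℚ n)) ⟩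
    (1ℚ + ℕ→ℚ m) + ℕ→ℚ n       ≡⟨ cong (_+ ℕ→ℚ n) (sym (ℕ→ℚ-suc m)) ⟩
    ℕ→ℚ (suc m) + ℕ→ℚ n        ∎
    where open ≡-Reasoning

  ∣ℕ→ℚ∣ : ∀ n → ∣ ℕ→ℚ n ∣ ≡ ℕ→ℚ n
  ∣ℕ→ℚ∣ n = trans (cong ∣_∣ (ℕ→ℚ≡mkℚ n)) (sym (ℕ→ℚ≡mkℚ n))

  ℕ→ℚ-*-1/ : ∀ n → ℕ→ℚ (suc n) * (ℤ.+ 1 / suc n) ≡ 1ℚ
  ℕ→ℚ-*-1/ n = trans
    (cong₂ _*_ (ℕ→ℚ≡mkℚ (suc n)) (normalize-coprime (Coprime.sym (coprimeTo1 (suc n)))))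
    (*-inverseʳ (mkℚ (ℤ.+ suc n) 0 (coprimeTo1 (suc n))))

  p*q≡0⇒p≡0∨q≡0 : ∀ p q → p * q ≡ 0ℚ → p ≡ 0ℚ ⊎ q ≡ 0ℚ
  p*q≡0⇒p≡0∨q≡0 p q pq≡0 with p ≟ 0ℚ
  ... | yes p≡0 = inj₁ p≡0
  ... | no p≢0 = inj₂ (begin
    q                ≡⟨ sym (*-identityˡ q) ⟩
    1ℚ * q           ≡⟨ cong (_* q) (sym (*-inverseˡ p)) ⟩
    (1/ p * p) * q   ≡⟨ *-assoc (1/ p) p q ⟩
    1/ p * (p * q)   ≡⟨ cong (1/ p *_) pq≡0 ⟩
    1/ p * 0ℚ        ≡⟨ *-zeroʳ (1/ p) ⟩
    0ℚ               ∎)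
    where
    open ≡-Reasoning
    instance _ = ≢-nonZero p≢0

  import Algebra.Properties.Group +-0-group as +-Group
  open +-Group public using () renaming (x∙y⁻¹≈ε⇒x≈y to p-q≡0⇒p≡q; ⁻¹-involutive to neg-involutive)
  open import Algebra.Properties.Quasigroup +-Group.quasigroup public using () renaming (cancelˡ to +-cancelˡ)

  *-distribˡ-- : ∀ p q r → p * (q - r) ≡ p * q - p * r
  *-distribˡ-- p q r = trans (*-distribˡ-+ p q (- r)) (cong (p * q +_) (sym (neg-distribʳ-* p r)))

  x*0-y≡-y : ∀ x y → x * 0ℚ - y ≡ - y
  x*0-y≡-y x y = trans (cong (_- y) (*-zeroʳ x)) (+-identityˡ (- y))

  p≡-p⇒p≡0 : ∀ p → p ≡ - p → p ≡ 0ℚ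
  p≡-p⇒p≡0 p p≡-p = [ (λ ()) , id ]′ (p*q≡0⇒p≡0∨q≡0 (1ℚ + 1ℚ) p 2p≡0)
    where
    2p≡0 : (1ℚ + 1ℚ) * p ≡ 0ℚ
    2p≡0 = trans (*-distribʳ-+ p 1ℚ 1ℚ)
      (trans (cong₂ _+_ (*-identityˡ p) (trans (*-identityˡ p) p≡-p)) (+-inverseʳ p))

module FinSum where
  open import Data.Nat using (zero; suc)
  open import Data.Fin using (Fin; zero; suc; punchIn)
  open import Data.Fin.Permutation using (Permutation; _⟨$⟩ʳ_)
  open import Data.Rational
  open import Data.Rational.Properties
  open import Relation.Binary.PropositionalEquality
  open import Algebra.Bundles using (CommutativeRing)
  open CommutativeRing +-*-commutativeRing using (semiring)
  open import Algebra.Properties.Semiring.Sum semiring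
    using (sum; sum-cong-≗; sum-replicate-zero; ∑-distrib-+; *-distribˡ-sum; sum-remove; ∑-comm; sum-permute)
  open import Algebra.Properties.Ring +-*-ring using (-1*x≈-x)
  open RationalFacts

  sumFin≡sum : ∀ {n} (f : Fin n → ℚ) → sumFin f ≡ sum f
  sumFin≡sum {zero}  f = refl
  sumFin≡sum {suc n} f = cong (f zero +_) (sumFin≡sum (λ i → f (suc i)))

  sumFin-cong : ∀ {n} {f g : Fin n → ℚ} → (∀ i → f i ≡ g i) → sumFin f ≡ sumFin g
  sumFin-cong {f = f} {g} f≗g = trans (sumFin≡sum f) (trans (sum-cong-≗ f≗g) (sym (sumFin≡sum g)))

  sumFin-zero : ∀ {n} {f : Fin n → ℚ} → (∀ i → f i ≡ 0ℚ) → sumFin f ≡ 0ℚ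
  sumFin-zero {n} f≗0 = trans (sumFin-cong f≗0) (trans (sumFin≡sum {n} (λ _ → 0ℚ)) (sum-replicate-zero n))

  sumFin-const : ∀ n c → sumFin {n} (λ _ → c) ≡ ℕ→ℚ n * c
  sumFin-const zero    c = sym (*-zeroˡ c)
  sumFin-const (suc n) c = begin
    c + sumFin {n} (λ _ → c)  ≡⟨ cong₂ _+_ (sym (*-identityˡ c)) (sumFin-const n c) ⟩
    1ℚ * c + ℕ→ℚ n * c        ≡⟨ sym (*-distribʳ-+ c 1ℚ (ℕ→ℚ n)) ⟩
    (1ℚ + ℕ→ℚ n) * c          ≡⟨ cong (_* c) (sym (ℕ→ℚ-suc n)) ⟩
    ℕ→ℚ (suc n) * c           ∎
    where open ≡-Reasoning

  sumFin-+ : ∀ {n} (f g : Fin n → ℚ) → sumFin (λ i → f i + g i) ≡ sumFin f + sumFin g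
  sumFin-+ f g = trans (sumFin≡sum (λ i → f i + g i)) (trans (∑-distrib-+ f g) (sym (cong₂ _+_ (sumFin≡sum f) (sumFin≡sum g))))

  *-distribˡ-sumFin : ∀ {n} c (f : Fin n → ℚ) → c * sumFin f ≡ sumFin (λ i → c * f i)
  *-distribˡ-sumFin c f = trans (cong (c *_) (sumFin≡sum f)) (trans (*-distribˡ-sum c f) (sym (sumFin≡sum (λ i → c * f i))))

  sumFin-remove : ∀ {n} (j : Fin (suc n)) (f : Fin (suc n) → ℚ) → sumFin f ≡ f j + sumFin (λ l → f (punchIn j l))
  sumFin-remove j f = trans (sumFin≡sum f) (trans (sum-remove {i = j} f) (cong (f j +_) (sym (sumFin≡sum (λ l → f (punchIn j l))))))

  sumFin-comm : ∀ {m n} (f : Fin m → Fin n → ℚ) →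
    sumFin (λ i → sumFin (λ j → f i j)) ≡ sumFin (λ j → sumFin (λ i → f i j))
  sumFin-comm f = begin
    sumFin (λ i → sumFin (f i))          ≡⟨ sumFin-cong (λ i → sumFin≡sum (f i)) ⟩
    sumFin (λ i → sum (f i))             ≡⟨ sumFin≡sum (λ i → sum (f i)) ⟩
    sum (λ i → sum (f i))                ≡⟨ ∑-comm f ⟩
    sum (λ j → sum (λ i → f i j))        ≡⟨ sym (sumFin≡sum (λ j → sum (λ i → f i j))) ⟩
    sumFin (λ j → sum (λ i → f i j))     ≡⟨ sumFin-cong (λ j → sym (sumFin≡sum (λ i → f i j))) ⟩
    sumFin (λ j → sumFin (λ i → f i j))  ∎
    where open ≡-Reasoning

  sumFin-permute : ∀ {m n} (π : Permutation m n) (f : Fin n → ℚ) → sumFin f ≡ sumFin (λ i → f (π ⟨$⟩ʳ i))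
  sumFin-permute π f = trans (sumFin≡sum f) (trans (sum-permute f π) (sym (sumFin≡sum (λ i → f (π ⟨$⟩ʳ i)))))

  sumFin-neg : ∀ {n} (f : Fin n → ℚ) → sumFin (λ i → - f i) ≡ - sumFin f
  sumFin-neg f = begin
    sumFin (λ i → - f i)       ≡⟨ sumFin-cong (λ i → sym (-1*x≈-x (f i))) ⟩
    sumFin (λ i → - 1ℚ * f i)  ≡⟨ sym (*-distribˡ-sumFin (- 1ℚ) f) ⟩
    - 1ℚ * sumFin f            ≡⟨ -1*x≈-x (sumFin f) ⟩
    - sumFin f                 ∎
    where open ≡-Reasoning

  sumFin-offDiagonal-transpose : ∀ {n} (f : Fin (suc n) → Fin (suc n) → ℚ) →
    sumFin (λ j → sumFin (λ l → f j (punchIn j l))) ≡ sumFin (λ j → sumFin (λ l → f (punchIn j l) j))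
  sumFin-offDiagonal-transpose f = +-cancelˡ diagonal _ _ (begin
    diagonal + sumFin (λ j → sumFin (λ l → f j (punchIn j l)))
      ≡⟨ sym (sumFin-+ (λ j → f j j) (λ j → sumFin (λ l → f j (punchIn j l)))) ⟩
    sumFin (λ j → f j j + sumFin (λ l → f j (punchIn j l)))
      ≡⟨ sumFin-cong (λ j → sym (sumFin-remove j (f j))) ⟩
    sumFin (λ j → sumFin (λ b → f j b))
      ≡⟨ sumFin-comm f ⟩
    sumFin (λ j → sumFin (λ a → f a j))
      ≡⟨ sumFin-cong (λ j → sumFin-remove j (λ a → f a j)) ⟩
    sumFin (λ j → f j j + sumFin (λ l → f (punchIn j l) j))
      ≡⟨ sumFin-+ (λ j → f j j) (λ j → sumFin (λ l → f (punchIn j l) j)) ⟩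
    diagonal + sumFin (λ j → sumFin (λ l → f (punchIn j l) j)) ∎)
    where
    open ≡-Reasoning
    diagonal = sumFin (λ j → f j j)

  sumFin-δ : ∀ {n} (c : Fin n) (f : Fin n → ℚ) → sumFin (λ j → δ c j * f j) ≡ f c
  sumFin-δ zero f = begin
    1ℚ * f zero + sumFin (λ j → 0ℚ * f (suc j))  ≡⟨ cong₂ _+_ (*-identityˡ (f zero)) (sumFin-zero (λ j → *-zeroˡ (f (suc j)))) ⟩
    f zero + 0ℚ                                   ≡⟨ +-identityʳ (f zero) ⟩
    f zero                                        ∎
    where open ≡-Reasoning
  sumFin-δ (suc c) f = trans (cong₂ _+_ (*-zeroˡ (f zero)) (sumFin-δ c (λ i → f (suc i)))) (+-identityˡ (f (suc c)))

module PolynomialFunction where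
  open import Data.Nat as ℕ using (ℕ; zero; suc; _≤_; z≤n; s≤s)
  import Data.Nat.Properties as ℕ
  open import Data.Product using (Σ; _×_; _,_)
  open import Data.Sum using (inj₁; inj₂)
  open import Data.Empty using (⊥-elim)
  open import Data.List using (List; []; _∷_; _++_; map; length; replicate)
  open import Data.List.Membership.Propositional using (_∈_)
  open import Data.List.Membership.Propositional.Properties using (∈-∃++)
  open import Data.List.Relation.Unary.Any using (here; there)
  open import Data.List.Relation.Binary.Permutation.Propositional using (_↭_; ↭-refl; ↭-prep; ↭-trans; ↭-sym; ↭⇒↭ₛ)
  open import Data.List.Relation.Binary.Permutation.Propositional.Properties using (map⁺; shift)
  open import Data.List.Relation.Binary.Permutation.Setoid.Properties using (foldr-commMonoid)
  open import Data.Rational using (ℚ; 0ℚ; 1ℚ; _+_; _*_; _-_; -_)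
  open import Data.Rational.Properties
  open import Data.Rational.Solver
  open +-*-Solver
  open import Algebra.Definitions.RawSemiring +-*-rawSemiring using (_^_)
  open import Relation.Binary.PropositionalEquality
  open RationalFacts

  -- Poly≤ d f: f is a polynomial function of degree at most d, described by
  -- the factor theorem: f t = (t - a) g t + f a with g of degree at most d - 1.
  Poly≤ : ℕ → (ℚ → ℚ) → Set
  Poly≤ zero    f = ∀ t → f t ≡ f 0ℚ
  Poly≤ (suc d) f = ∀ a → Σ (ℚ → ℚ) λ g → Poly≤ d g × (∀ t → f t ≡ (t - a) * g t + f a)

  Poly≤-const : ∀ d c → Poly≤ d (λ _ → c)
  Poly≤-const zero    c t = refl
  Poly≤-const (suc d) c a = (λ _ → 0ℚ) , Poly≤-const d 0ℚ ,
    λ t → solve 3 (λ c t a → c := (t :- a) :* con 0ℚ :+ c) refl c t a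

  Poly≤-+ : ∀ d {f g} → Poly≤ d f → Poly≤ d g → Poly≤ d (λ t → f t + g t)
  Poly≤-+ zero    pf pg t = cong₂ _+_ (pf t) (pg t)
  Poly≤-+ (suc d) {f} {g} pf pg a with pf a | pg a
  ... | f′ , pf′ , f≡ | g′ , pg′ , g≡ = (λ t → f′ t + g′ t) , Poly≤-+ d pf′ pg′ , λ t →
    trans (cong₂ _+_ (f≡ t) (g≡ t))
      (solve 6 (λ t a x y fa ga → ((t :- a) :* x :+ fa) :+ ((t :- a) :* y :+ ga) := (t :- a) :* (x :+ y) :+ (fa :+ ga))
         refl t a (f′ t) (g′ t) (f a) (g a))

  Poly≤-- : ∀ d {f g} → Poly≤ d f → Poly≤ d g → Poly≤ d (λ t → f t - g t)
  Poly≤-- zero    pf pg t = cong₂ _-_ (pf t) (pg t)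
  Poly≤-- (suc d) {f} {g} pf pg a with pf a | pg a
  ... | f′ , pf′ , f≡ | g′ , pg′ , g≡ = (λ t → f′ t - g′ t) , Poly≤-- d pf′ pg′ , λ t →
    trans (cong₂ _-_ (f≡ t) (g≡ t))
      (solve 6 (λ t a x y fa ga → ((t :- a) :* x :+ fa) :- ((t :- a) :* y :+ ga) := (t :- a) :* (x :- y) :+ (fa :- ga))
         refl t a (f′ t) (g′ t) (f a) (g a))

  Poly≤-suc : ∀ d {f} → Poly≤ d f → Poly≤ (suc d) f
  Poly≤-suc zero    {f} pf a = (λ _ → 0ℚ) , (λ _ → refl) , λ t →
    trans (trans (pf t) (sym (pf a))) (solve 3 (λ t a fa → fa := (t :- a) :* con 0ℚ :+ fa) refl t a (f a))
  Poly≤-suc (suc d) pf a with pf a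
  ... | g , pg , f≡ = g , Poly≤-suc d pg , f≡

  Poly≤-mono : ∀ {d e f} → d ≤ e → Poly≤ d f → Poly≤ e f
  Poly≤-mono {e = zero}  z≤n       pf = pf
  Poly≤-mono {e = suc e} z≤n       pf = Poly≤-suc e (Poly≤-mono {e = e} z≤n pf)
  Poly≤-mono             (s≤s d≤e) pf a with pf a
  ... | g , pg , f≡ = g , Poly≤-mono d≤e pg , f≡

  Poly≤-linear* : ∀ d b {g} → Poly≤ d g → Poly≤ (suc d) (λ t → (t - b) * g t)
  Poly≤-linear* zero    b {g} pg a = (λ _ → g 0ℚ) , (λ _ → refl) , λ t → begin
    (t - b) * g t                      ≡⟨ cong ((t - b) *_) (pg t) ⟩
    (t - b) * g 0ℚ                     ≡⟨ solve 4 (λ t a b c → (t :- b) :* c := (t :- a) :* c :+ (a :- b) :* c) refl t a b (g 0ℚ) ⟩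
    (t - a) * g 0ℚ + (a - b) * g 0ℚ    ≡⟨ cong (λ c → (t - a) * g 0ℚ + (a - b) * c) (sym (pg a)) ⟩
    (t - a) * g 0ℚ + (a - b) * g a     ∎
    where open ≡-Reasoning
  Poly≤-linear* (suc d) b {g} pg a with pg a
  ... | g′ , pg′ , g≡ =
    (λ t → (t - b) * g′ t + g a) , Poly≤-+ (suc d) (Poly≤-linear* d b pg′) (Poly≤-const (suc d) (g a)) , λ t →
    trans (cong ((t - b) *_) (g≡ t))
      (solve 5 (λ t a b x ga → (t :- b) :* ((t :- a) :* x :+ ga) := (t :- a) :* ((t :- b) :* x :+ ga) :+ (a :- b) :* ga)
         refl t a b (g′ t) (g a))

  Poly≤-vanish : ∀ d {f} → Poly≤ d f → (pts : ℕ → ℚ) → (∀ {i j} → pts i ≡ pts j → i ≡ j) →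
    (∀ i → i ≤ d → f (pts i) ≡ 0ℚ) → ∀ t → f t ≡ 0ℚ
  Poly≤-vanish zero    pf pts _ f[pts]≡0 t = trans (pf t) (trans (sym (pf (pts 0))) (f[pts]≡0 0 z≤n))
  Poly≤-vanish (suc d) {f} pf pts pts-injective f[pts]≡0 t with pf (pts (suc d))
  ... | g , pg , f≡ = begin
    f t                  ≡⟨ f≡ t ⟩
    (t - a) * g t + f a  ≡⟨ cong₂ (λ x y → (t - a) * x + y) (g≡0 t) fa≡0 ⟩
    (t - a) * 0ℚ + 0ℚ    ≡⟨ solve 2 (λ t a → (t :- a) :* con 0ℚ :+ con 0ℚ := con 0ℚ) refl t a ⟩
    0ℚ                   ∎
    where
    open ≡-Reasoning
    a = pts (suc d)
    fa≡0 = f[pts]≡0 (suc d) ℕ.≤-refl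
    g[pts]≡0 : ∀ i → i ≤ d → g (pts i) ≡ 0ℚ
    g[pts]≡0 i i≤d with p*q≡0⇒p≡0∨q≡0 (pts i - a) (g (pts i)) (begin
      (pts i - a) * g (pts i)               ≡⟨ sym (+-identityʳ ((pts i - a) * g (pts i))) ⟩
      (pts i - a) * g (pts i) + 0ℚ          ≡⟨ cong ((pts i - a) * g (pts i) +_) (sym fa≡0) ⟩
      (pts i - a) * g (pts i) + f a         ≡⟨ sym (f≡ (pts i)) ⟩
      f (pts i)                             ≡⟨ f[pts]≡0 i (ℕ.m≤n⇒m≤1+n i≤d) ⟩
      0ℚ                                    ∎)
    ... | inj₁ pts-i≡a = ⊥-elim (ℕ.<-irrefl (pts-injective (p-q≡0⇒p≡q _ _ pts-i≡a)) (s≤s i≤d))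
    ... | inj₂ g≡0     = g≡0
    g≡0 = Poly≤-vanish d pg pts pts-injective g[pts]≡0

  Poly≤-vanish-off : ∀ d {f} a → Poly≤ d f → (∀ t → t ≢ a → f t ≡ 0ℚ) → ∀ t → f t ≡ 0ℚ
  Poly≤-vanish-off d a pf f≡0 = Poly≤-vanish d pf pts pts-injective (λ i _ → f≡0 (pts i) (pts≢a i))
    where
    pts : ℕ → ℚ
    pts i = a + ℕ→ℚ (suc i)
    pts-injective : ∀ {i j} → pts i ≡ pts j → i ≡ j
    pts-injective eq = ℕ.suc-injective (ℕ→ℚ-injective (+-cancelˡ a _ _ eq))
    pts≢a : ∀ i → pts i ≢ a
    pts≢a i eq = ℕ.1+n≢0 {i} (ℕ→ℚ-injective (+-cancelˡ a _ _ (trans eq (sym (+-identityʳ a)))))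

  charPoly : List ℚ → ℚ → ℚ
  charPoly μs t = prodList (map (λ μ → t - μ) μs)

  Poly≤-charPoly : ∀ μs → Poly≤ (length μs) (charPoly μs)
  Poly≤-charPoly []       = Poly≤-const 0 1ℚ
  Poly≤-charPoly (μ ∷ μs) = Poly≤-linear* (length μs) μ (Poly≤-charPoly μs)

  charPoly-↭ : ∀ {μs νs} → μs ↭ νs → ∀ t → charPoly μs t ≡ charPoly νs t
  charPoly-↭ μs↭νs t = foldr-commMonoid (setoid ℚ) *-1-isCommutativeMonoid (↭⇒↭ₛ (map⁺ (λ μ → t - μ) μs↭νs))

  charPoly-replicate : ∀ n c ys t → charPoly (replicate n c ++ ys) t ≡ (t - c) ^ n * charPoly ys t
  charPoly-replicate zero    c ys t = sym (*-identityˡ (charPoly ys t))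
  charPoly-replicate (suc n) c ys t = trans (cong ((t - c) *_) (charPoly-replicate n c ys t))
    (sym (*-assoc (t - c) ((t - c) ^ n) (charPoly ys t)))

  charPoly-∷-root : ∀ μ μs → charPoly (μ ∷ μs) μ ≡ 0ℚ
  charPoly-∷-root μ μs = trans (cong (_* charPoly μs μ) (+-inverseʳ μ)) (*-zeroˡ (charPoly μs μ))

  charPoly-root : ∀ μs {a} → charPoly μs a ≡ 0ℚ → a ∈ μs
  charPoly-root []       1≡0 = ⊥-elim (1≢0 1≡0)
  charPoly-root (μ ∷ μs) {a} eq with p*q≡0⇒p≡0∨q≡0 (a - μ) (charPoly μs a) eq
  ... | inj₁ a-μ≡0 = here (p-q≡0⇒p≡q a μ a-μ≡0)
  ... | inj₂ rest≡0 = there (charPoly-root μs rest≡0)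

  charPoly-cancel : ∀ a μs νs → (∀ t → (t - a) * charPoly μs t ≡ (t - a) * charPoly νs t) →
    ∀ t → charPoly μs t ≡ charPoly νs t
  charPoly-cancel a μs νs eq t = p-q≡0⇒p≡q _ _ (Poly≤-vanish-off d a (Poly≤-- d pμ pν) diff≡0 t)
    where
    open ≡-Reasoning
    d = length μs ℕ.+ length νs
    pμ : Poly≤ d (charPoly μs)
    pμ = Poly≤-mono (ℕ.m≤m+n (length μs) (length νs)) (Poly≤-charPoly μs)
    pν : Poly≤ d (charPoly νs)
    pν = Poly≤-mono (ℕ.m≤n+m (length νs) (length μs)) (Poly≤-charPoly νs)
    diff≡0 : ∀ t → t ≢ a → charPoly μs t - charPoly νs t ≡ 0ℚ
    diff≡0 t t≢a with p*q≡0⇒p≡0∨q≡0 (t - a) (charPoly μs t - charPoly νs t) (begin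
      (t - a) * (charPoly μs t - charPoly νs t)            ≡⟨ *-distribˡ-- (t - a) (charPoly μs t) (charPoly νs t) ⟩
      (t - a) * charPoly μs t - (t - a) * charPoly νs t    ≡⟨ cong (_- (t - a) * charPoly νs t) (eq t) ⟩
      (t - a) * charPoly νs t - (t - a) * charPoly νs t    ≡⟨ +-inverseʳ ((t - a) * charPoly νs t) ⟩
      0ℚ                                                   ∎)
    ... | inj₁ t-a≡0 = ⊥-elim (t≢a (p-q≡0⇒p≡q t a t-a≡0))
    ... | inj₂ diff≡0 = diff≡0

  charPoly-injective : ∀ μs νs → (∀ t → charPoly μs t ≡ charPoly νs t) → μs ↭ νs
  charPoly-injective []       []       _  = ↭-refl
  charPoly-injective []       (ν ∷ νs) eq = ⊥-elim (1≢0 (trans (eq ν) (charPoly-∷-root ν νs)))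
  charPoly-injective (μ ∷ μs) νs       eq
    with ys , zs , refl ← ∈-∃++ (charPoly-root νs {μ} (trans (sym (eq μ)) (charPoly-∷-root μ μs)))
    = ↭-trans (↭-prep μ (charPoly-injective μs (ys ++ zs) (charPoly-cancel μ μs (ys ++ zs) μ∷μs≗μ∷ys++zs)))
              (↭-sym (shift μ ys zs))
    where
    μ∷μs≗μ∷ys++zs : ∀ t → charPoly (μ ∷ μs) t ≡ charPoly (μ ∷ ys ++ zs) t
    μ∷μs≗μ∷ys++zs t = trans (eq t) (charPoly-↭ (shift μ ys zs) t)

module SpectralSum where
  open import Data.Nat using (zero; suc)
  open import Data.List using (_++_; replicate)
  open import Data.List.Relation.Binary.Permutation.Propositional using (_↭_; ↭⇒↭ₛ)
  open import Data.List.Relation.Binary.Permutation.Propositional.Properties using (map⁺)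
  open import Data.List.Relation.Binary.Permutation.Setoid.Properties using (foldr-commMonoid)
  open import Data.Rational using (ℚ; _+_; _-_; ∣_∣)
  open import Data.Rational.Properties using (+-0-isCommutativeMonoid; +-inverseʳ; +-identityˡ)
  open import Relation.Binary.PropositionalEquality
  open PolynomialFunction using (charPoly-injective)

  spectrum-unique : ∀ {k} {M : Matrix k} {μs νs} → HasSpectrum M μs → HasSpectrum M νs → μs ↭ νs
  spectrum-unique {μs = μs} {νs} hasμs hasνs = charPoly-injective μs νs (λ t → trans (sym (hasμs t)) (hasνs t))

  shiftedAbsSum-↭ : ∀ c {μs νs} → μs ↭ νs → shiftedAbsSum c μs ≡ shiftedAbsSum c νs
  shiftedAbsSum-↭ c μs↭νs = foldr-commMonoid (setoid ℚ) +-0-isCommutativeMonoid (↭⇒↭ₛ (map⁺ (λ μ → ∣ μ - c ∣) μs↭νs))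

  spectralSumIs : ∀ {k} {M : Matrix k} {νs} c {e} → HasSpectrum M νs → shiftedAbsSum c νs ≡ e → SpectralSumIs M c e
  spectralSumIs {M = M} {νs} c hasνs sum≡e μs hasμs =
    trans (shiftedAbsSum-↭ c {μs} {νs} (spectrum-unique {M = M} {μs} {νs} hasμs hasνs)) sum≡e

  shiftedAbsSum-replicate : ∀ c n ys → shiftedAbsSum c (replicate n c ++ ys) ≡ shiftedAbsSum c ys
  shiftedAbsSum-replicate c zero    ys = refl
  shiftedAbsSum-replicate c (suc n) ys =
    trans (cong₂ _+_ (cong ∣_∣ (+-inverseʳ c)) (shiftedAbsSum-replicate c n ys)) (+-identityˡ (shiftedAbsSum c ys))

module Determinant where
  open import Data.Nat using (zero; suc)
  open import Data.Fin using (Fin; zero; suc; punchIn; lift)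
  open import Data.Rational using (ℚ; 0ℚ; 1ℚ; _+_; _*_; _-_; -_)
  open import Data.Rational.Properties
  open import Data.Rational.Solver
  open +-*-Solver
  open import Algebra.Definitions.RawSemiring +-*-rawSemiring using (_^_)
  open import Relation.Binary.PropositionalEquality
  open RationalFacts
  open FinSum

  minor : ∀ {n} → Matrix (suc n) → Fin (suc n) → Matrix n
  minor M j r c = M (suc r) (punchIn j c)

  withRow0 : ∀ {n} → Matrix (suc n) → (Fin (suc n) → ℚ) → Matrix (suc n)
  withRow0 M v zero    = v
  withRow0 M v (suc r) = M (suc r)

  det-cong : ∀ {n} {M N : Matrix n} → (∀ i j → M i j ≡ N i j) → det M ≡ det N
  det-cong {zero}  M≗N = refl
  det-cong {suc n} M≗N = sumFin-cong λ j →
    cong₂ (λ x d → sgn j * (x * d)) (M≗N zero j) (det-cong (λ r c → M≗N (suc r) (punchIn j c)))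

  det-row0-linear : ∀ {n} (M : Matrix (suc n)) x y (P Q : Fin (suc n) → ℚ) →
    (∀ j → M zero j ≡ x * P j + y * Q j) →
    det M ≡ x * det (withRow0 M P) + y * det (withRow0 M Q)
  det-row0-linear M x y P Q row0 = begin
    sumFin (λ j → sgn j * (M zero j * det (minor M j)))
      ≡⟨ sumFin-cong (λ j → trans (cong (λ z → sgn j * (z * det (minor M j))) (row0 j))
           (solve 6 (λ s x y p q d → s :* ((x :* p :+ y :* q) :* d) := x :* (s :* (p :* d)) :+ y :* (s :* (q :* d)))
              refl (sgn j) x y (P j) (Q j) (det (minor M j)))) ⟩
    sumFin (λ j → x * expandP j + y * expandQ j)
      ≡⟨ sumFin-+ (λ j → x * expandP j) (λ j → y * expandQ j) ⟩
    sumFin (λ j → x * expandP j) + sumFin (λ j → y * expandQ j)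
      ≡⟨ sym (cong₂ _+_ (*-distribˡ-sumFin x expandP) (*-distribˡ-sumFin y expandQ)) ⟩
    x * det (withRow0 M P) + y * det (withRow0 M Q)  ∎
    where
    open ≡-Reasoning
    expandP expandQ : Fin _ → ℚ
    expandP j = sgn j * (P j * det (minor M j))
    expandQ j = sgn j * (Q j * det (minor M j))

  det-row0-unit : ∀ {n} (M : Matrix (suc n)) a → (∀ j → M zero j ≡ δ a j) → det M ≡ sgn a * det (minor M a)
  det-row0-unit M a row0 = trans
    (sumFin-cong (λ j → trans (cong (λ z → sgn j * (z * det (minor M j))) (row0 j))
      (solve 3 (λ s u d → s :* (u :* d) := u :* (s :* d)) refl (sgn j) (δ a j) (det (minor M j)))))
    (sumFin-δ a (λ j → sgn j * det (minor M j)))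

  mutual
    det-col0-zero : ∀ {n} (M : Matrix (suc n)) → (∀ i → M i zero ≡ 0ℚ) → det M ≡ 0ℚ
    det-col0-zero M col0 = begin
      det M                            ≡⟨ det-col0 M (λ i → col0 (suc i)) ⟩
      M zero zero * det (minor M zero) ≡⟨ cong (_* det (minor M zero)) (col0 zero) ⟩
      0ℚ * det (minor M zero)          ≡⟨ *-zeroˡ (det (minor M zero)) ⟩
      0ℚ                               ∎
      where open ≡-Reasoning

    det-col0 : ∀ {n} (M : Matrix (suc n)) → (∀ i → M (suc i) zero ≡ 0ℚ) →
      det M ≡ M zero zero * det (minor M zero)
    det-col0 {zero}  M _    = trans (+-identityʳ (1ℚ * (M zero zero * 1ℚ))) (*-identityˡ (M zero zero * 1ℚ))
    det-col0 {suc n} M col0 = begin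
      1ℚ * (M zero zero * det (minor M zero)) + sumFin (λ j → sgn (suc j) * (M zero (suc j) * det (minor M (suc j))))
        ≡⟨ cong₂ _+_ (*-identityˡ (M zero zero * det (minor M zero))) (sumFin-zero other≡0) ⟩
      M zero zero * det (minor M zero) + 0ℚ
        ≡⟨ +-identityʳ (M zero zero * det (minor M zero)) ⟩
      M zero zero * det (minor M zero) ∎
      where
      open ≡-Reasoning
      other≡0 : ∀ j → sgn (suc j) * (M zero (suc j) * det (minor M (suc j))) ≡ 0ℚ
      other≡0 j = begin
        sgn (suc j) * (M zero (suc j) * det (minor M (suc j)))
          ≡⟨ cong (λ d → sgn (suc j) * (M zero (suc j) * d)) (det-col0-zero (minor M (suc j)) col0) ⟩
        sgn (suc j) * (M zero (suc j) * 0ℚ)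
          ≡⟨ cong (sgn (suc j) *_) (*-zeroʳ (M zero (suc j))) ⟩
        sgn (suc j) * 0ℚ
          ≡⟨ *-zeroʳ (sgn (suc j)) ⟩
        0ℚ ∎

  det-scalar : ∀ {n} (M : Matrix n) x → (∀ i j → M i j ≡ x * δ i j) → det M ≡ x ^ n
  det-scalar {zero}  M x _    = refl
  det-scalar {suc n} M x M≡xI = trans
    (det-col0 M (λ i → trans (M≡xI (suc i) zero) (*-zeroʳ x)))
    (cong₂ _*_ (trans (M≡xI zero zero) (*-identityʳ x)) (det-scalar (minor M zero) x (λ i j → M≡xI (suc i) (suc j))))

  sgn-suc : ∀ {n} (j : Fin n) → sgn (suc j) ≡ - sgn j
  sgn-suc zero    = refl
  sgn-suc (suc j) = trans (sym (neg-involutive (sgn j))) (cong -_ (sym (sgn-suc j)))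

  sgn-sq : ∀ {n} (j : Fin n) → sgn j * sgn j ≡ 1ℚ
  sgn-sq zero          = refl
  sgn-sq (suc zero)    = refl
  sgn-sq (suc (suc j)) = sgn-sq j

  -- pairSign a b = sgn a * sgn (position of b once column a is deleted);
  -- the diagonal value is never used.
  pairSign : ∀ {n} → Fin n → Fin n → ℚ
  pairSign zero    zero    = 0ℚ
  pairSign zero    (suc b) = sgn b
  pairSign (suc a) zero    = - sgn a
  pairSign (suc a) (suc b) = pairSign a b

  pairSign-punchIn : ∀ {n} (j : Fin (suc n)) (l : Fin n) → pairSign j (punchIn j l) ≡ sgn j * sgn l
  pairSign-punchIn zero    l       = sym (*-identityˡ (sgn l))
  pairSign-punchIn (suc j) zero    = trans (sym (*-identityʳ (- sgn j))) (cong (_* 1ℚ) (sym (sgn-suc j)))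
  pairSign-punchIn (suc j) (suc l) = begin
    pairSign j (punchIn j l)        ≡⟨ pairSign-punchIn j l ⟩
    sgn j * sgn l                   ≡⟨ solve 2 (λ a b → a :* b := (:- a) :* (:- b)) refl (sgn j) (sgn l) ⟩
    (- sgn j) * (- sgn l)           ≡⟨ sym (cong₂ _*_ (sgn-suc j) (sgn-suc l)) ⟩
    sgn (suc j) * sgn (suc l)       ∎
    where open ≡-Reasoning

  pairSign-anti : ∀ {n} (j : Fin (suc n)) (l : Fin n) → pairSign (punchIn j l) j ≡ - pairSign j (punchIn j l)
  pairSign-anti zero    l       = refl
  pairSign-anti (suc j) zero    = sym (neg-involutive (sgn j))
  pairSign-anti (suc j) (suc l) = pairSign-anti j l

  -- punchIn₂ a b enumerates the columns other than a and b
  punchIn₂ : ∀ {n} → Fin (suc (suc n)) → Fin (suc (suc n)) → Fin n → Fin (suc (suc n))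
  punchIn₂ zero    zero    c = zero
  punchIn₂ zero    (suc b) c = suc (punchIn b c)
  punchIn₂ (suc a) zero    c = suc (punchIn a c)
  punchIn₂ {suc n} (suc a) (suc b) zero    = zero
  punchIn₂ {suc n} (suc a) (suc b) (suc c) = suc (punchIn₂ a b c)

  punchIn-punchIn : ∀ {n} (j : Fin (suc (suc n))) (l : Fin (suc n)) (c : Fin n) →
    punchIn j (punchIn l c) ≡ punchIn₂ j (punchIn j l) c
  punchIn-punchIn zero    l       c       = refl
  punchIn-punchIn (suc j) zero    c       = refl
  punchIn-punchIn {suc n} (suc j) (suc l) zero    = refl
  punchIn-punchIn {suc n} (suc j) (suc l) (suc c) = cong suc (punchIn-punchIn j l c)

  punchIn₂-sym : ∀ {n} (a b : Fin (suc (suc n))) (c : Fin n) → punchIn₂ a b c ≡ punchIn₂ b a c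
  punchIn₂-sym zero    zero    c = refl
  punchIn₂-sym zero    (suc b) c = refl
  punchIn₂-sym (suc a) zero    c = refl
  punchIn₂-sym {suc n} (suc a) (suc b) zero    = refl
  punchIn₂-sym {suc n} (suc a) (suc b) (suc c) = cong suc (punchIn₂-sym a b c)

  minor₂ : ∀ {n} → Matrix (suc (suc n)) → Fin (suc (suc n)) → Fin (suc (suc n)) → ℚ
  minor₂ M a b = det (λ r c → M (suc (suc r)) (punchIn₂ a b c))

  det-expand₂ : ∀ {n} (M : Matrix (suc (suc n))) → det M ≡
    sumFin (λ j → sumFin (λ l → pairSign j (punchIn j l) * (M zero j * (M (suc zero) (punchIn j l) * minor₂ M j (punchIn j l)))))
  det-expand₂ M = sumFin-cong λ j → begin
    sgn j * (M zero j * det (minor M j))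
      ≡⟨ cong (sgn j *_) (*-distribˡ-sumFin (M zero j) (inner j)) ⟩
    sgn j * sumFin (λ l → M zero j * inner j l)
      ≡⟨ *-distribˡ-sumFin (sgn j) (λ l → M zero j * inner j l) ⟩
    sumFin (λ l → sgn j * (M zero j * inner j l))
      ≡⟨ sumFin-cong (regroup j) ⟩
    sumFin (λ l → pairSign j (punchIn j l) * (M zero j * (M (suc zero) (punchIn j l) * minor₂ M j (punchIn j l)))) ∎
    where
    open ≡-Reasoning
    inner : ∀ j → Fin _ → ℚ
    inner j l = sgn l * (M (suc zero) (punchIn j l) * det (minor (minor M j) l))
    regroup : ∀ j l → sgn j * (M zero j * inner j l) ≡
      pairSign j (punchIn j l) * (M zero j * (M (suc zero) (punchIn j l) * minor₂ M j (punchIn j l)))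
    regroup j l = begin
      sgn j * (M zero j * (sgn l * (M (suc zero) b * det (minor (minor M j) l))))
        ≡⟨ solve 5 (λ s x t y d → s :* (x :* (t :* (y :* d))) := (s :* t) :* (x :* (y :* d))) refl
             (sgn j) (M zero j) (sgn l) (M (suc zero) b) (det (minor (minor M j) l)) ⟩
      (sgn j * sgn l) * (M zero j * (M (suc zero) b * det (minor (minor M j) l)))
        ≡⟨ cong₂ (λ s d → s * (M zero j * (M (suc zero) b * d)))
             (sym (pairSign-punchIn j l)) (det-cong (λ r c → cong (M (suc (suc r))) (punchIn-punchIn j l c))) ⟩
      pairSign j b * (M zero j * (M (suc zero) b * minor₂ M j b)) ∎
      where b = punchIn j l

  swap01 : ∀ {n} → Fin (suc (suc n)) → Fin (suc (suc n))
  swap01 zero          = suc zero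
  swap01 (suc zero)    = zero
  swap01 (suc (suc i)) = suc (suc i)

  -- In the expansion along rows 0 and 1, swapping the rows exchanges the two
  -- column indices of every term, and pairSign is antisymmetric.
  det-swap01 : ∀ {n} (M : Matrix (suc (suc n))) → det (λ r → M (swap01 r)) ≡ - det M
  det-swap01 M = begin
    det (λ r → M (swap01 r))
      ≡⟨ det-expand₂ (λ r → M (swap01 r)) ⟩
    sumFin (λ j → sumFin (λ l → swapped j (punchIn j l)))
      ≡⟨ sumFin-cong (λ j → sumFin-cong (λ l → swapped≡-term j l)) ⟩
    sumFin (λ j → sumFin (λ l → - term (punchIn j l) j))
      ≡⟨ sumFin-cong (λ j → sumFin-neg (λ l → term (punchIn j l) j)) ⟩
    sumFin (λ j → - sumFin (λ l → term (punchIn j l) j))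
      ≡⟨ sumFin-neg (λ j → sumFin (λ l → term (punchIn j l) j)) ⟩
    - sumFin (λ j → sumFin (λ l → term (punchIn j l) j))
      ≡⟨ cong -_ (sym (sumFin-offDiagonal-transpose term)) ⟩
    - sumFin (λ j → sumFin (λ l → term j (punchIn j l)))
      ≡⟨ cong -_ (sym (det-expand₂ M)) ⟩
    - det M ∎
    where
    open ≡-Reasoning
    term swapped : Fin _ → Fin _ → ℚ
    term    a b = pairSign a b * (M zero a * (M (suc zero) b * minor₂ M a b))
    swapped a b = pairSign a b * (M (suc zero) a * (M zero b * minor₂ M a b))
    swapped≡-term : ∀ j l → swapped j (punchIn j l) ≡ - term (punchIn j l) j
    swapped≡-term j l = begin
      pairSign j b * (M (suc zero) j * (M zero b * minor₂ M j b))
        ≡⟨ cong (λ d → pairSign j b * (M (suc zero) j * (M zero b * d)))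
             (det-cong (λ r c → cong (M (suc (suc r))) (punchIn₂-sym j b c))) ⟩
      pairSign j b * (M (suc zero) j * (M zero b * minor₂ M b j))
        ≡⟨ solve 4 (λ s x y d → s :* (x :* (y :* d)) := :- ((:- s) :* (y :* (x :* d)))) refl
             (pairSign j b) (M (suc zero) j) (M zero b) (minor₂ M b j) ⟩
      - (- pairSign j b * (M zero b * (M (suc zero) j * minor₂ M b j)))
        ≡⟨ cong (λ s → - (s * (M zero b * (M (suc zero) j * minor₂ M b j)))) (sym (pairSign-anti j l)) ⟩
      - (pairSign b j * (M zero b * (M (suc zero) j * minor₂ M b j))) ∎
      where b = punchIn j l

  rotate : ∀ {n} → Fin (suc n) → Fin (suc n) → Fin (suc n)
  rotate a zero    = a
  rotate a (suc i) = punchIn a i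

  mutual
    det-rotate : ∀ {n} (a : Fin (suc n)) (M : Matrix (suc n)) → det (λ r → M (rotate a r)) ≡ sgn a * det M
    det-rotate zero M = begin
      det (λ r → M (rotate zero r)) ≡⟨ det-cong {M = λ r → M (rotate zero r)} {N = M} (λ { zero c → refl ; (suc r) c → refl }) ⟩
      det M                         ≡⟨ sym (*-identityˡ (det M)) ⟩
      1ℚ * det M                    ∎
      where open ≡-Reasoning
    det-rotate {suc n} (suc a) M = begin
      det (λ r → M (rotate (suc a) r))
        ≡⟨ det-cong {M = λ r → M (rotate (suc a) r)} {N = λ r → M (lift 1 (rotate a) (swap01 r))} rotate-suc ⟩
      det (λ r → M (lift 1 (rotate a) (swap01 r)))  ≡⟨ det-swap01 (λ r → M (lift 1 (rotate a) r)) ⟩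
      - det (λ r → M (lift 1 (rotate a) r))         ≡⟨ cong -_ (det-lift-rotate a M) ⟩
      - (sgn a * det M)                             ≡⟨ neg-distribˡ-* (sgn a) (det M) ⟩
      - sgn a * det M                               ≡⟨ cong (_* det M) (sym (sgn-suc a)) ⟩
      sgn (suc a) * det M                           ∎
      where
      open ≡-Reasoning
      rotate-suc : ∀ r c → M (rotate (suc a) r) c ≡ M (lift 1 (rotate a) (swap01 r)) c
      rotate-suc zero          c = refl
      rotate-suc (suc zero)    c = refl
      rotate-suc (suc (suc r)) c = refl

    det-lift-rotate : ∀ {n} (a : Fin (suc n)) (M : Matrix (suc (suc n))) →
      det (λ r → M (lift 1 (rotate a) r)) ≡ sgn a * det M
    det-lift-rotate a M = begin
      sumFin (λ j → sgn j * (M zero j * det (λ r → minor M j (rotate a r))))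
        ≡⟨ sumFin-cong (λ j → cong (λ d → sgn j * (M zero j * d)) (det-rotate a (minor M j))) ⟩
      sumFin (λ j → sgn j * (M zero j * (sgn a * det (minor M j))))
        ≡⟨ sumFin-cong (λ j → solve 4 (λ s x t d → s :* (x :* (t :* d)) := t :* (s :* (x :* d))) refl
             (sgn j) (M zero j) (sgn a) (det (minor M j))) ⟩
      sumFin (λ j → sgn a * (sgn j * (M zero j * det (minor M j))))
        ≡⟨ sym (*-distribˡ-sumFin (sgn a) (λ j → sgn j * (M zero j * det (minor M j)))) ⟩
      sgn a * det M ∎
      where open ≡-Reasoning

  -- Moving row a + 1 up to row 1 multiplies det by sgn a, and the result is
  -- unchanged by swapping its (equal) rows 0 and 1.
  det-equalRows : ∀ {n} (a : Fin (suc n)) (M : Matrix (suc (suc n))) → (∀ c → M zero c ≡ M (suc a) c) → det M ≡ 0ℚ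
  det-equalRows a M row0≡rowa = begin
    det M
      ≡⟨ sym (*-identityˡ (det M)) ⟩
    1ℚ * det M
      ≡⟨ cong (_* det M) (sym (sgn-sq a)) ⟩
    (sgn a * sgn a) * det M
      ≡⟨ *-assoc (sgn a) (sgn a) (det M) ⟩
    sgn a * (sgn a * det M)
      ≡⟨ cong (sgn a *_) (sym (det-lift-rotate a M)) ⟩
    sgn a * det N
      ≡⟨ cong (sgn a *_) (p≡-p⇒p≡0 (det N) (trans (sym (det-cong {M = λ r → N (swap01 r)} N∘swap01≗N)) (det-swap01 N))) ⟩
    sgn a * 0ℚ
      ≡⟨ *-zeroʳ (sgn a) ⟩
    0ℚ ∎
    where
    open ≡-Reasoning
    N : Matrix _
    N r = M (lift 1 (rotate a) r)
    N∘swap01≗N : ∀ r c → N (swap01 r) c ≡ N r c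
    N∘swap01≗N zero          c = sym (row0≡rowa c)
    N∘swap01≗N (suc zero)    c = row0≡rowa c
    N∘swap01≗N (suc (suc r)) c = refl

module CompleteBipartite where
  open import Data.Nat as ℕ using (ℕ; zero; suc; parity)
  import Data.Nat.Properties as ℕ
  open import Data.Fin using (Fin; zero; suc; punchIn; toℕ)
  open import Data.Fin.Properties using (any?)
  open import Data.Parity.Base using (Parity; 0ℙ; 1ℙ)
  open import Data.Parity.Properties using (_≟_)
  open import Data.Product using (_,_)
  open import Data.Empty using (⊥-elim)
  open import Function using (_∘_)
  open import Data.Rational using (ℚ; 0ℚ; 1ℚ; _+_; _*_; _-_; -_; +-*-rawSemiring)
  open import Data.Rational.Properties using (*-zeroʳ; *-identityˡ; +-identityˡ; +-identityʳ; neg-distribˡ-*)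
  open import Data.Rational.Solver
  open +-*-Solver
  open import Algebra.Definitions.RawSemiring +-*-rawSemiring using (_^_)
  open import Relation.Binary.PropositionalEquality
  open import Relation.Nullary using (yes; no)
  open RationalFacts
  open FinSum
  open Determinant

  cross : ℚ → Parity → Parity → ℚ
  cross α 0ℙ 0ℙ = 0ℚ
  cross α 0ℙ 1ℙ = α
  cross α 1ℙ 0ℙ = α
  cross α 1ℙ 1ℙ = 0ℚ

  cross-≡ : ∀ α {p q} → p ≡ q → cross α p q ≡ 0ℚ
  cross-≡ α {0ℙ} refl = refl
  cross-≡ α {1ℙ} refl = refl

  cross-≢ : ∀ α {p q} → p ≢ q → cross α p q ≡ α
  cross-≢ α {0ℙ} {0ℙ} p≢q = ⊥-elim (p≢q refl)
  cross-≢ α {0ℙ} {1ℙ} _   = refl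
  cross-≢ α {1ℙ} {0ℙ} _   = refl
  cross-≢ α {1ℙ} {1ℙ} p≢q = ⊥-elim (p≢q refl)

  ≢-≢⇒≡ : ∀ {p q r : Parity} → p ≢ q → r ≢ p → r ≡ q
  ≢-≢⇒≡ {0ℙ} {0ℙ}      p≢q _   = ⊥-elim (p≢q refl)
  ≢-≢⇒≡ {0ℙ} {1ℙ} {0ℙ} _   r≢p = ⊥-elim (r≢p refl)
  ≢-≢⇒≡ {0ℙ} {1ℙ} {1ℙ} _   _   = refl
  ≢-≢⇒≡ {1ℙ} {0ℙ} {0ℙ} _   _   = refl
  ≢-≢⇒≡ {1ℙ} {0ℙ} {1ℙ} _   r≢p = ⊥-elim (r≢p refl)
  ≢-≢⇒≡ {1ℙ} {1ℙ}      p≢q _   = ⊥-elim (p≢q refl)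

  δ-punchIn : ∀ {n} (a : Fin (suc n)) (r c : Fin n) → δ (punchIn a r) (punchIn a c) ≡ δ r c
  δ-punchIn zero    r       c       = refl
  δ-punchIn (suc a) zero    zero    = refl
  δ-punchIn (suc a) zero    (suc c) = refl
  δ-punchIn (suc a) (suc r) zero    = refl
  δ-punchIn (suc a) (suc r) (suc c) = δ-punchIn a r c

  δ-punchIn-self : ∀ {n} (a : Fin (suc n)) (c : Fin n) → δ a (punchIn a c) ≡ 0ℚ
  δ-punchIn-self zero    c       = refl
  δ-punchIn-self (suc a) zero    = refl
  δ-punchIn-self (suc a) (suc c) = δ-punchIn-self a c

  cross-neg : ∀ α p q → cross (- α) p q ≡ - cross α p q
  cross-neg α 0ℙ 0ℙ = refl
  cross-neg α 0ℙ 1ℙ = refl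
  cross-neg α 1ℙ 0ℙ = refl
  cross-neg α 1ℙ 1ℙ = refl

  completeBipartite : ∀ {n} → (Fin n → Parity) → Matrix n
  completeBipartite s i j = cross 1ℚ (s i) (s j)

  countOpposite : ∀ {n} → Parity → (Fin n → Parity) → ℚ
  countOpposite p s = sumFin (λ i → cross 1ℚ p (s i))

  edgeCount : ∀ {n} → (Fin n → Parity) → ℚ
  edgeCount {zero}  s = 0ℚ
  edgeCount {suc n} s = countOpposite (s zero) (s ∘ suc) + edgeCount (s ∘ suc)

  edgeCount≡ : ∀ {n} (s : Fin n → Parity) → edgeCount s ≡ countOpposite 0ℙ s * countOpposite 1ℙ s
  edgeCount≡ {zero}  s = refl
  edgeCount≡ {suc n} s = trans (cong (countOpposite (s zero) (s ∘ suc) +_) (edgeCount≡ (s ∘ suc))) (split (s zero))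
    where
    A = countOpposite 0ℙ (s ∘ suc)
    B = countOpposite 1ℙ (s ∘ suc)
    split : ∀ p → countOpposite p (s ∘ suc) + A * B ≡ (cross 1ℚ 0ℙ p + A) * (cross 1ℚ 1ℙ p + B)
    split 0ℙ = solve 2 (λ A B → A :+ A :* B := (con 0ℚ :+ A) :* (con 1ℚ :+ B)) refl A B
    split 1ℙ = solve 2 (λ A B → B :+ A :* B := (con 1ℚ :+ A) :* (con 0ℚ :+ B)) refl A B

  countOpposite-parity : ∀ m p → countOpposite p (λ (a : Fin (2 ℕ.* m)) → parity (toℕ a)) ≡ ℕ→ℚ m
  countOpposite-parity zero    p = refl
  countOpposite-parity (suc m) p = begin
    countOpposite p (λ (a : Fin (2 ℕ.* suc m)) → parity (toℕ a))
      ≡⟨ cong (λ n → countOpposite p (λ (a : Fin n) → parity (toℕ a))) (ℕ.*-suc 2 m) ⟩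
    cross 1ℚ p 0ℙ + (cross 1ℚ p 1ℙ + countOpposite p (λ (a : Fin (2 ℕ.* m)) → parity (toℕ a)))
      ≡⟨ cong (λ c → cross 1ℚ p 0ℙ + (cross 1ℚ p 1ℙ + c)) (countOpposite-parity m p) ⟩
    cross 1ℚ p 0ℙ + (cross 1ℚ p 1ℙ + ℕ→ℚ m)
      ≡⟨ one-of-each p ⟩
    1ℚ + ℕ→ℚ m
      ≡⟨ sym (ℕ→ℚ-suc m) ⟩
    ℕ→ℚ (suc m) ∎
    where
    open ≡-Reasoning
    one-of-each : ∀ p → cross 1ℚ p 0ℙ + (cross 1ℚ p 1ℙ + ℕ→ℚ m) ≡ 1ℚ + ℕ→ℚ m
    one-of-each 0ℙ = +-identityˡ (1ℚ + ℕ→ℚ m)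
    one-of-each 1ℙ = cong (1ℚ +_) (+-identityˡ (ℕ→ℚ m))

  module _ (x α : ℚ) where

    bipartite : ∀ {n} → (Fin n → Parity) → Matrix n
    bipartite s i j = x * δ i j - cross α (s i) (s j)

    -- rows labelled u, σ and columns labelled v, σ: up to the order of the rows,
    -- the minor of a bipartite matrix at the row of v and the column of u
    bordered : ∀ {n} → Parity → Parity → (Fin n → Parity) → Matrix (suc n)
    bordered su sv σ zero    zero    = - cross α su sv
    bordered su sv σ zero    (suc c) = - cross α su (σ c)
    bordered su sv σ (suc r) zero    = - cross α (σ r) sv
    bordered su sv σ (suc r) (suc c) = bipartite σ r c

    bordered-minor : ∀ {n} su sv (σ : Fin (suc n) → Parity) a → σ a ≡ su →
      ∀ r c → minor (bordered su sv σ) (suc a) (rotate a r) c ≡ bordered su sv (σ ∘ punchIn a) r c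
    bordered-minor su sv σ a refl zero    zero    = refl
    bordered-minor su sv σ a refl zero    (suc c) =
      trans (cong (λ d → x * d - cross α (σ a) (σ (punchIn a c))) (δ-punchIn-self a c)) (x*0-y≡-y x _)
    bordered-minor su sv σ a refl (suc r) zero    = refl
    bordered-minor su sv σ a refl (suc r) (suc c) =
      cong (λ d → x * d - cross α (σ (punchIn a r)) (σ (punchIn a c))) (δ-punchIn a r c)

    bipartite-minor : ∀ {n} (s : Fin (suc (suc n)) → Parity) l →
      ∀ r c → minor (bipartite s) (suc l) (rotate l r) c ≡ bordered (s (suc l)) (s zero) (s ∘ suc ∘ punchIn l) r c
    bipartite-minor s l zero    zero    = x*0-y≡-y x _
    bipartite-minor s l zero    (suc c) =
      trans (cong (λ d → x * d - cross α (s (suc l)) (s (suc (punchIn l c)))) (δ-punchIn-self l c)) (x*0-y≡-y x _)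
    bipartite-minor s l (suc r) zero    = x*0-y≡-y x _
    bipartite-minor s l (suc r) (suc c) =
      cong (λ d → x * d - cross α (s (suc (punchIn l r))) (s (suc (punchIn l c)))) (δ-punchIn l r c)

    mutual
      det-bordered : ∀ {n} su sv (σ : Fin n → Parity) → su ≢ sv → det (bordered su sv σ) ≡ - α * x ^ n
      det-bordered su sv σ su≢sv with any? (λ a → σ a ≟ su)
      ... | yes (a , σa≡su) = det-bordered-via-row su sv σ a σa≡su su≢sv
      ... | no  ∄a          = det-bordered-via-col su sv σ (λ a σa≡su → ∄a (a , σa≡su)) su≢sv

      -- row 0 is row a minus x times the unit vector at a
      det-bordered-via-row : ∀ {n} su sv (σ : Fin n → Parity) a → σ a ≡ su → su ≢ sv →
        det (bordered su sv σ) ≡ - α * x ^ n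
      det-bordered-via-row {suc n} su sv σ a σa≡su su≢sv = begin
        det N
          ≡⟨ det-row0-linear N 1ℚ (- x) (N (suc a)) (δ (suc a)) row0 ⟩
        1ℚ * det (withRow0 N (N (suc a))) + - x * det (withRow0 N (δ (suc a)))
          ≡⟨ cong₂ (λ d e → 1ℚ * d + - x * e) (det-equalRows a (withRow0 N (N (suc a))) (λ _ → refl))
               (det-row0-unit (withRow0 N (δ (suc a))) (suc a) (λ _ → refl)) ⟩
        1ℚ * 0ℚ + - x * (sgn (suc a) * D)
          ≡⟨ cong (λ s → 1ℚ * 0ℚ + - x * (s * D)) (sgn-suc a) ⟩
        1ℚ * 0ℚ + - x * (- sgn a * D)
          ≡⟨ solve 3 (λ x s d → con 1ℚ :* con 0ℚ :+ (:- x) :* ((:- s) :* d) := x :* (s :* d)) refl x (sgn a) D ⟩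
        x * (sgn a * D)
          ≡⟨ cong (x *_) (sym (det-rotate a (minor N (suc a)))) ⟩
        x * det (λ r → minor N (suc a) (rotate a r))
          ≡⟨ cong (x *_) (det-cong (bordered-minor su sv σ a σa≡su)) ⟩
        x * det (bordered su sv (σ ∘ punchIn a))
          ≡⟨ cong (x *_) (det-bordered su sv (σ ∘ punchIn a) su≢sv) ⟩
        x * (- α * x ^ n)
          ≡⟨ solve 3 (λ x a p → x :* ((:- a) :* p) := (:- a) :* (x :* p)) refl x α (x ^ n) ⟩
        - α * x ^ suc n ∎
        where
        open ≡-Reasoning
        N = bordered su sv σ
        D = det (minor N (suc a))
        row0 : ∀ j → N zero j ≡ 1ℚ * N (suc a) j + - x * δ (suc a) j
        row0 zero    rewrite σa≡su = solve 2 (λ c x → :- c := con 1ℚ :* (:- c) :+ (:- x) :* con 0ℚ) refl (cross α su sv) x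
        row0 (suc c) rewrite σa≡su =
          solve 3 (λ c x d → :- c := con 1ℚ :* (x :* d :- c) :+ (:- x) :* d) refl (cross α su (σ c)) x (δ a c)

      -- column 0 is -α times the unit vector and the rest is x I
      det-bordered-via-col : ∀ {n} su sv (σ : Fin n → Parity) → (∀ a → σ a ≢ su) → su ≢ sv →
        det (bordered su sv σ) ≡ - α * x ^ n
      det-bordered-via-col {n} su sv σ σ≢su su≢sv = begin
        det (bordered su sv σ)
          ≡⟨ det-col0 (bordered su sv σ) (λ r → cong -_ (cross-≡ α (σ≡sv r))) ⟩
        - cross α su sv * det (bipartite σ)
          ≡⟨ cong₂ (λ c d → - c * d) (cross-≢ α su≢sv) (det-scalar (bipartite σ) x bipartite-σ≡xI) ⟩
        - α * x ^ n ∎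
        where
        open ≡-Reasoning
        σ≡sv : ∀ a → σ a ≡ sv
        σ≡sv a = ≢-≢⇒≡ su≢sv (σ≢su a)
        bipartite-σ≡xI : ∀ r c → bipartite σ r c ≡ x * δ r c
        bipartite-σ≡xI r c =
          trans (cong (λ e → x * δ r c - e) (cross-≡ α (trans (σ≡sv r) (sym (σ≡sv c))))) (+-identityʳ (x * δ r c))

    det-bipartite-expand : ∀ {n} (s : Fin (suc n) → Parity) → det (bipartite s) ≡
      x * det (bipartite (s ∘ suc)) + sumFin (λ l → sgn (suc l) * (- cross α (s zero) (s (suc l)) * det (minor (bipartite s) (suc l))))
    det-bipartite-expand s = begin
      det K
        ≡⟨ det-row0-linear K x 1ℚ (δ zero) w (λ j → cong (x * δ zero j +_) (sym (*-identityˡ (w j)))) ⟩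
      x * det (withRow0 K (δ zero)) + 1ℚ * det (withRow0 K w)
        ≡⟨ cong₂ (λ d e → x * d + e) (trans (det-row0-unit (withRow0 K (δ zero)) zero (λ _ → refl)) (*-identityˡ _))
             (*-identityˡ (det (withRow0 K w))) ⟩
      x * det (bipartite (s ∘ suc)) + (1ℚ * (w zero * det (minor K zero)) + rest)
        ≡⟨ cong (λ c → x * det (bipartite (s ∘ suc)) + (1ℚ * (- c * det (minor K zero)) + rest)) (cross-≡ α {s zero} refl) ⟩
      x * det (bipartite (s ∘ suc)) + (1ℚ * (- 0ℚ * det (minor K zero)) + rest)
        ≡⟨ cong (x * det (bipartite (s ∘ suc)) +_)
             (solve 2 (λ d r → con 1ℚ :* ((:- con 0ℚ) :* d) :+ r := r) refl (det (minor K zero)) rest) ⟩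
      x * det (bipartite (s ∘ suc)) + rest ∎
      where
      open ≡-Reasoning
      K = bipartite s
      w : Fin _ → ℚ
      w j = - cross α (s zero) (s j)
      rest = sumFin (λ l → sgn (suc l) * (w (suc l) * det (minor K (suc l))))

    edge-term : ∀ {n} (s : Fin (suc (suc n)) → Parity) l →
      sgn (suc l) * (- cross α (s zero) (s (suc l)) * det (minor (bipartite s) (suc l))) ≡
      - (α * α * x ^ n) * cross 1ℚ (s zero) (s (suc l))
    edge-term {n} s l with s (suc l) ≟ s zero
    ... | yes same = begin
      sgn (suc l) * (- cross α (s zero) (s (suc l)) * D)
        ≡⟨ cong (λ c → sgn (suc l) * (- c * D)) (cross-≡ α (sym same)) ⟩
      sgn (suc l) * (- 0ℚ * D)
        ≡⟨ solve 3 (λ s d y → s :* ((:- con 0ℚ) :* d) := y :* con 0ℚ) refl (sgn (suc l)) D (- (α * α * x ^ n)) ⟩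
      - (α * α * x ^ n) * 0ℚ
        ≡⟨ cong (- (α * α * x ^ n) *_) (sym (cross-≡ 1ℚ (sym same))) ⟩
      - (α * α * x ^ n) * cross 1ℚ (s zero) (s (suc l)) ∎
      where
      open ≡-Reasoning
      D = det (minor (bipartite s) (suc l))
    ... | no differ = begin
      sgn (suc l) * (- cross α (s zero) (s (suc l)) * D)
        ≡⟨ cong₂ (λ t c → t * (- c * D)) (sgn-suc l) (cross-≢ α (differ ∘ sym)) ⟩
      - sgn l * (- α * D)
        ≡⟨ solve 3 (λ t a d → (:- t) :* ((:- a) :* d) := a :* (t :* d)) refl (sgn l) α D ⟩
      α * (sgn l * D)
        ≡⟨ cong (α *_) (sym (det-rotate l (minor (bipartite s) (suc l)))) ⟩
      α * det (λ r → minor (bipartite s) (suc l) (rotate l r))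
        ≡⟨ cong (α *_) (det-cong (bipartite-minor s l)) ⟩
      α * det (bordered (s (suc l)) (s zero) (s ∘ suc ∘ punchIn l))
        ≡⟨ cong (α *_) (det-bordered (s (suc l)) (s zero) (s ∘ suc ∘ punchIn l) differ) ⟩
      α * (- α * x ^ n)
        ≡⟨ solve 2 (λ a p → a :* ((:- a) :* p) := (:- (a :* a :* p)) :* con 1ℚ) refl α (x ^ n) ⟩
      - (α * α * x ^ n) * 1ℚ
        ≡⟨ cong (- (α * α * x ^ n) *_) (sym (cross-≢ 1ℚ (differ ∘ sym))) ⟩
      - (α * α * x ^ n) * cross 1ℚ (s zero) (s (suc l)) ∎
      where
      open ≡-Reasoning
      D = det (minor (bipartite s) (suc l))

    det-bipartite-step : ∀ {n} (s : Fin (suc (suc n)) → Parity) →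
      det (bipartite s) ≡ x * det (bipartite (s ∘ suc)) - α * α * x ^ n * countOpposite (s zero) (s ∘ suc)
    det-bipartite-step {n} s = begin
      det (bipartite s)
        ≡⟨ det-bipartite-expand s ⟩
      x * det (bipartite (s ∘ suc)) + sumFin (λ l → sgn (suc l) * (- cross α (s zero) (s (suc l)) * det (minor (bipartite s) (suc l))))
        ≡⟨ cong (x * det (bipartite (s ∘ suc)) +_) (sumFin-cong (edge-term s)) ⟩
      x * det (bipartite (s ∘ suc)) + sumFin (λ l → - (α * α * x ^ n) * cross 1ℚ (s zero) (s (suc l)))
        ≡⟨ cong (x * det (bipartite (s ∘ suc)) +_)
             (sym (*-distribˡ-sumFin (- (α * α * x ^ n)) (λ l → cross 1ℚ (s zero) (s (suc l))))) ⟩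
      x * det (bipartite (s ∘ suc)) + - (α * α * x ^ n) * countOpposite (s zero) (s ∘ suc)
        ≡⟨ cong (x * det (bipartite (s ∘ suc)) +_) (sym (neg-distribˡ-* (α * α * x ^ n) (countOpposite (s zero) (s ∘ suc)))) ⟩
      x * det (bipartite (s ∘ suc)) - α * α * x ^ n * countOpposite (s zero) (s ∘ suc) ∎
      where open ≡-Reasoning

    det-bipartite-1 : (s : Fin 1 → Parity) → det (bipartite s) ≡ x
    det-bipartite-1 s = begin
      1ℚ * ((x * 1ℚ - cross α (s zero) (s zero)) * 1ℚ) + 0ℚ
        ≡⟨ cong (λ c → 1ℚ * ((x * 1ℚ - c) * 1ℚ) + 0ℚ) (cross-≡ α {s zero} refl) ⟩
      1ℚ * ((x * 1ℚ - 0ℚ) * 1ℚ) + 0ℚ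
        ≡⟨ solve 1 (λ x → con 1ℚ :* ((x :* con 1ℚ :- con 0ℚ) :* con 1ℚ) :+ con 0ℚ := x) refl x ⟩
      x ∎
      where open ≡-Reasoning

    det-bipartite : ∀ {n} (s : Fin (suc (suc n)) → Parity) → det (bipartite s) ≡ x ^ n * (x * x - α * α * edgeCount s)
    det-bipartite {zero} s = begin
      det (bipartite s)
        ≡⟨ det-bipartite-step s ⟩
      x * det (bipartite (s ∘ suc)) - α * α * 1ℚ * c
        ≡⟨ cong (λ d → x * d - α * α * 1ℚ * c) (det-bipartite-1 (s ∘ suc)) ⟩
      x * x - α * α * 1ℚ * c
        ≡⟨ solve 3 (λ x a c → x :* x :- a :* a :* con 1ℚ :* c
                             := con 1ℚ :* (x :* x :- a :* a :* (c :+ (con 0ℚ :+ con 0ℚ)))) refl x α c ⟩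
      1ℚ * (x * x - α * α * (c + (0ℚ + 0ℚ))) ∎
      where
      open ≡-Reasoning
      c = countOpposite (s zero) (s ∘ suc)
    det-bipartite {suc n} s = begin
      det (bipartite s)
        ≡⟨ det-bipartite-step s ⟩
      x * det (bipartite (s ∘ suc)) - α * α * x ^ suc n * c
        ≡⟨ cong (λ d → x * d - α * α * x ^ suc n * c) (det-bipartite (s ∘ suc)) ⟩
      x * (x ^ n * (x * x - α * α * e)) - α * α * x ^ suc n * c
        ≡⟨ solve 5 (λ x a p c e → x :* (p :* (x :* x :- a :* a :* e)) :- a :* a :* (x :* p) :* c
                                 := (x :* p) :* (x :* x :- a :* a :* (c :+ e))) refl x α (x ^ n) c e ⟩
      x ^ suc n * (x * x - α * α * (c + e)) ∎
      where
      open ≡-Reasoning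
      c = countOpposite (s zero) (s ∘ suc)
      e = edgeCount (s ∘ suc)

module ModularArithmetic where
  open import Data.Nat as ℕ using (ℕ; zero; suc; _+_; _∸_; _%_)
  import Data.Nat.Properties as ℕ
  open import Data.Nat.DivMod using (_mod_; %-distribˡ-+; m%n%n≡m%n; [m+n]%n≡m%n; m<n⇒m%n≡m)
  open import Data.Fin using (Fin; zero; suc; toℕ)
  open import Data.Fin.Properties using (toℕ-fromℕ<; toℕ-injective; toℕ<n)
  open import Relation.Binary.PropositionalEquality

  toℕ-addMod : ∀ {n} (a b : Fin (suc n)) → toℕ (addMod a b) ≡ (toℕ a + toℕ b) % suc n
  toℕ-addMod a b = toℕ-fromℕ< _

  addMod-comm : ∀ {n} (a b : Fin (suc n)) → addMod a b ≡ addMod b a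
  addMod-comm {n} a b = cong (_mod suc n) (ℕ.+-comm (toℕ a) (toℕ b))

  addMod-identityˡ : ∀ {n} (a : Fin (suc n)) → addMod zero a ≡ a
  addMod-identityˡ a = toℕ-injective (trans (toℕ-addMod zero a) (m<n⇒m%n≡m (toℕ<n a)))

  addMod-identityʳ : ∀ {n} (a : Fin (suc n)) → addMod a zero ≡ a
  addMod-identityʳ a = trans (addMod-comm a zero) (addMod-identityˡ a)

  addMod-cancelˡ : ∀ {n} (e a a′ : Fin (suc n)) → addMod e a ≡ addMod e a′ → a ≡ a′
  addMod-cancelˡ {n} e a a′ eq = toℕ-injective (trans (sym (undo a)) (trans (cong (λ s → (N ∸ toℕ e + toℕ s) % N) eq) (undo a′)))
    where
    N = suc n
    undo : ∀ a → (N ∸ toℕ e + toℕ (addMod e a)) % N ≡ toℕ a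
    undo a = begin
      (N ∸ toℕ e + toℕ (addMod e a)) % N
        ≡⟨ cong (λ r → (N ∸ toℕ e + r) % N) (toℕ-addMod e a) ⟩
      (N ∸ toℕ e + (toℕ e + toℕ a) % N) % N
        ≡⟨ %-distribˡ-+ (N ∸ toℕ e) ((toℕ e + toℕ a) % N) N ⟩
      ((N ∸ toℕ e) % N + (toℕ e + toℕ a) % N % N) % N
        ≡⟨ cong (λ r → ((N ∸ toℕ e) % N + r) % N) (m%n%n≡m%n (toℕ e + toℕ a) N) ⟩
      ((N ∸ toℕ e) % N + (toℕ e + toℕ a) % N) % N
        ≡⟨ sym (%-distribˡ-+ (N ∸ toℕ e) (toℕ e + toℕ a) N) ⟩
      (N ∸ toℕ e + (toℕ e + toℕ a)) % N
        ≡⟨ cong (_% N) wrap ⟩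
      (toℕ a + N) % N
        ≡⟨ [m+n]%n≡m%n (toℕ a) N ⟩
      toℕ a % N
        ≡⟨ m<n⇒m%n≡m (toℕ<n a) ⟩
      toℕ a ∎
      where
      open ≡-Reasoning
      wrap : N ∸ toℕ e + (toℕ e + toℕ a) ≡ toℕ a + N
      wrap = trans (sym (ℕ.+-assoc (N ∸ toℕ e) (toℕ e) (toℕ a)))
        (trans (cong (_+ toℕ a) (ℕ.m∸n+n≡m (ℕ.<⇒≤ (toℕ<n e)))) (ℕ.+-comm N (toℕ a)))

  addMod-cancelʳ : ∀ {n} (e a a′ : Fin (suc n)) → addMod a e ≡ addMod a′ e → a ≡ a′
  addMod-cancelʳ e a a′ eq = addMod-cancelˡ e a a′ (trans (addMod-comm e a) (trans eq (addMod-comm a′ e)))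

module GroupU (k : ℕ) where
  open import Data.Nat as ℕ using (ℕ; zero; suc; parity)
  open import Data.Fin using (Fin; zero; suc; toℕ)
  open import Data.Fin.Patterns using (0F; 1F; 2F)
  open import Data.Parity.Base using (Parity; 0ℙ; 1ℙ)
  open import Data.Product using (_,_; proj₁; proj₂)
  open import Data.Sum using (_⊎_; inj₁; inj₂)
  open import Data.Empty using (⊥-elim)
  open import Relation.Nullary using (¬_)
  open import Relation.Binary.PropositionalEquality
  open ModularArithmetic

  -- m ≥ 2 makes 2 * m reduce to a double successor, so that 1F : Fin (2 * m) is x
  m : ℕ
  m = suc (suc k)

  parityᶠ : Fin (2 ℕ.* m) → Parity
  parityᶠ a = parity (toℕ a)

  flip : Parity → Fin 3 → Fin 3
  flip 0ℙ b = b
  flip 1ℙ b = negMod b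

  signAct≡flip : ∀ n b → signAct n b ≡ flip (parity n) b
  signAct≡flip zero          b = refl
  signAct≡flip (suc zero)    b = refl
  signAct≡flip (suc (suc n)) b = signAct≡flip n b

  mulU≡ : ∀ a b c d → mulU m (a , b) (c , d) ≡ (addMod a c , addMod (flip (parityᶠ c) b) d)
  mulU≡ a b c d = cong (λ b′ → addMod a c , addMod b′ d) (signAct≡flip (toℕ c) b)

  negMod-involutive : ∀ (b : Fin 3) → negMod (negMod b) ≡ b
  negMod-involutive 0F = refl
  negMod-involutive 1F = refl
  negMod-involutive 2F = refl

  negMod-fixed : ∀ (b : Fin 3) → negMod b ≡ b → b ≡ 0F
  negMod-fixed 0F _  = refl
  negMod-fixed 1F ()
  negMod-fixed 2F ()

  flip-0F : ∀ p → flip p 0F ≡ 0F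
  flip-0F 0ℙ = refl
  flip-0F 1ℙ = refl

  flip-injective : ∀ p {b b′} → flip p b ≡ flip p b′ → b ≡ b′
  flip-injective 0ℙ eq = eq
  flip-injective 1ℙ {b} {b′} eq = trans (sym (negMod-involutive b)) (trans (cong negMod eq) (negMod-involutive b′))

  -- the conjugator (0 , b′ - b) of the odd case
  -f+b≡b′+f : ∀ (b b′ : Fin 3) → let f = addMod b′ (negMod b) in addMod (negMod f) b ≡ addMod b′ f
  -f+b≡b′+f 0F 0F = refl
  -f+b≡b′+f 0F 1F = refl
  -f+b≡b′+f 0F 2F = refl
  -f+b≡b′+f 1F 0F = refl
  -f+b≡b′+f 1F 1F = refl
  -f+b≡b′+f 1F 2F = refl
  -f+b≡b′+f 2F 0F = refl
  -f+b≡b′+f 2F 1F = refl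
  -f+b≡b′+f 2F 2F = refl

  nonzero-Z3 : ∀ {b b′ : Fin 3} → b ≢ 0F → b′ ≢ 0F → b ≡ b′ ⊎ b ≡ negMod b′
  nonzero-Z3 {0F}          b≢0 _    = ⊥-elim (b≢0 refl)
  nonzero-Z3 {_}  {0F}     _   b′≢0 = ⊥-elim (b′≢0 refl)
  nonzero-Z3 {1F} {1F}     _   _    = inj₁ refl
  nonzero-Z3 {1F} {2F}     _   _    = inj₂ refl
  nonzero-Z3 {2F} {1F}     _   _    = inj₂ refl
  nonzero-Z3 {2F} {2F}     _   _    = inj₁ refl

  Commute : U m → U m → Set
  Commute g h = mulU m g h ≡ mulU m h g

  commute-even : ∀ a b c d → parityᶠ a ≡ 0ℙ → parityᶠ c ≡ 0ℙ → Commute (a , b) (c , d)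
  commute-even a b c d pa≡0 pc≡0 = begin
    mulU m (a , b) (c , d)                             ≡⟨ mulU≡ a b c d ⟩
    (addMod a c , addMod (flip (parityᶠ c) b) d)       ≡⟨ cong₂ _,_ (addMod-comm a c) second ⟩
    (addMod c a , addMod (flip (parityᶠ a) d) b)       ≡⟨ sym (mulU≡ c d a b) ⟩
    mulU m (c , d) (a , b)                             ∎
    where
    open ≡-Reasoning
    second : addMod (flip (parityᶠ c) b) d ≡ addMod (flip (parityᶠ a) d) b
    second = trans (cong (λ p → addMod (flip p b) d) pc≡0)
      (trans (addMod-comm b d) (cong (λ p → addMod (flip p d) b) (sym pa≡0)))

  commute-x : ∀ a c → Commute (a , 0F) (c , 0F)
  commute-x a c = begin
    mulU m (a , 0F) (c , 0F)                           ≡⟨ mulU≡ a 0F c 0F ⟩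
    (addMod a c , addMod (flip (parityᶠ c) 0F) 0F)     ≡⟨ cong₂ _,_ (addMod-comm a c) second ⟩
    (addMod c a , addMod (flip (parityᶠ a) 0F) 0F)     ≡⟨ sym (mulU≡ c 0F a 0F) ⟩
    mulU m (c , 0F) (a , 0F)                           ∎
    where
    open ≡-Reasoning
    second = trans (cong (λ b → addMod b 0F) (flip-0F (parityᶠ c))) (cong (λ b → addMod b 0F) (sym (flip-0F (parityᶠ a))))

  central-even : ∀ {a} → parityᶠ a ≡ 0ℙ → Central m (a , 0F)
  central-even {a} pa≡0 (c , d) = begin
    mulU m (a , 0F) (c , d)                            ≡⟨ mulU≡ a 0F c d ⟩
    (addMod a c , addMod (flip (parityᶠ c) 0F) d)      ≡⟨ cong₂ _,_ (addMod-comm a c) second ⟩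
    (addMod c a , addMod (flip (parityᶠ a) d) 0F)      ≡⟨ sym (mulU≡ c d a 0F) ⟩
    mulU m (c , d) (a , 0F)                            ∎
    where
    open ≡-Reasoning
    second : addMod (flip (parityᶠ c) 0F) d ≡ addMod (flip (parityᶠ a) d) 0F
    second = begin
      addMod (flip (parityᶠ c) 0F) d  ≡⟨ cong (λ b → addMod b d) (flip-0F (parityᶠ c)) ⟩
      addMod 0F d                     ≡⟨ addMod-identityˡ d ⟩
      d                               ≡⟨ sym (addMod-identityʳ d) ⟩
      addMod d 0F                     ≡⟨ cong (λ p → addMod (flip p d) 0F) (sym pa≡0) ⟩
      addMod (flip (parityᶠ a) d) 0F  ∎

  Commute⇒snd : ∀ a b c d → Commute (a , b) (c , d) →
    addMod (flip (parityᶠ c) b) d ≡ addMod (flip (parityᶠ a) d) b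
  Commute⇒snd a b c d comm = cong proj₂ (trans (sym (mulU≡ a b c d)) (trans comm (mulU≡ c d a b)))

  nonCentral-a1 : ∀ a → ¬ Central m (a , 1F)
  nonCentral-a1 a central with parityᶠ a in pa
  ... | 0ℙ = 2F≢1F (trans (Commute⇒snd a 1F 1F 0F (central (1F , 0F))) (cong (λ p → addMod (flip p 0F) 1F) pa))
    where
    2F≢1F : 2F ≢ 1F
    2F≢1F ()
  ... | 1ℙ = 2F≢0F (trans (Commute⇒snd a 1F 0F 1F (central (0F , 1F))) (cong (λ p → addMod (flip p 1F) 1F) pa))
    where
    2F≢0F : 2F ≢ 0F
    2F≢0F ()

  commute-even-odd : ∀ a b c d → parityᶠ a ≡ 0ℙ → parityᶠ c ≡ 1ℙ → Commute (a , b) (c , d) → b ≡ 0F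
  commute-even-odd a b c d pa≡0 pc≡1 comm = negMod-fixed b (addMod-cancelʳ d (negMod b) b (begin
    addMod (negMod b) d               ≡⟨ cong (λ p → addMod (flip p b) d) (sym pc≡1) ⟩
    addMod (flip (parityᶠ c) b) d     ≡⟨ Commute⇒snd a b c d comm ⟩
    addMod (flip (parityᶠ a) d) b     ≡⟨ cong (λ p → addMod (flip p d) b) pa≡0 ⟩
    addMod d b                        ≡⟨ addMod-comm d b ⟩
    addMod b d                        ∎))
    where open ≡-Reasoning

  mulU-cancelʳ : ∀ g h z → mulU m g z ≡ mulU m h z → g ≡ h
  mulU-cancelʳ (a , b) (a′ , b′) (e , f) eq = cong₂ _,_ (addMod-cancelʳ e a a′ (cong proj₁ eq))
    (flip-injective (parityᶠ e) (addMod-cancelʳ f _ _ (cong proj₂ (trans (sym (mulU≡ a b e f)) (trans eq (mulU≡ a′ b′ e f))))))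

  conj-central : ∀ g h → Central m g → Conj m g h → g ≡ h
  conj-central g h central (z , zg≡hz) = mulU-cancelʳ g h z (trans (central z) zg≡hz)

  conj-fst : ∀ g h → Conj m g h → proj₁ g ≡ proj₁ h
  conj-fst (a , _) (a′ , _) ((e , _) , eq) = addMod-cancelˡ e a a′ (trans (cong proj₁ eq) (addMod-comm a′ e))

  conj-refl : ∀ g → Conj m g g
  conj-refl (a , b) = (0F , 0F) , (begin
    mulU m (0F , 0F) (a , b)                       ≡⟨ mulU≡ 0F 0F a b ⟩
    (addMod 0F a , addMod (flip (parityᶠ a) 0F) b) ≡⟨ cong₂ _,_ (addMod-comm 0F a) second ⟩
    (addMod a 0F , addMod b 0F)                    ≡⟨ sym (mulU≡ a b 0F 0F) ⟩
    mulU m (a , b) (0F , 0F)                       ∎)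
    where
    open ≡-Reasoning
    second = trans (cong (λ b₀ → addMod b₀ b) (flip-0F (parityᶠ a))) (addMod-comm 0F b)

  conj-odd : ∀ a b b′ → parityᶠ a ≡ 1ℙ → Conj m (a , b) (a , b′)
  conj-odd a b b′ pa≡1 = (0F , f) , (begin
    mulU m (0F , f) (a , b)
      ≡⟨ mulU≡ 0F f a b ⟩
    (addMod 0F a , addMod (flip (parityᶠ a) f) b)
      ≡⟨ cong₂ _,_ (addMod-comm 0F a) (trans (cong (λ p → addMod (flip p f) b) pa≡1) (-f+b≡b′+f b b′)) ⟩
    (addMod a 0F , addMod b′ f)
      ≡⟨ sym (mulU≡ a b′ 0F f) ⟩
    mulU m (a , b′) (0F , f) ∎)
    where
    open ≡-Reasoning
    f = addMod b′ (negMod b)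

  conj-even : ∀ {a b b′} → parityᶠ a ≡ 0ℙ → b ≢ 0F → b′ ≢ 0F → Conj m (a , b) (a , b′)
  conj-even {a} {b} {b′} pa≡0 b≢0 b′≢0 with nonzero-Z3 b≢0 b′≢0
  ... | inj₁ refl = conj-refl (a , b)
  ... | inj₂ refl = (1F , 0F) , (begin
    mulU m (1F , 0F) (a , negMod b′)                         ≡⟨ mulU≡ 1F 0F a (negMod b′) ⟩
    (addMod 1F a , addMod (flip (parityᶠ a) 0F) (negMod b′)) ≡⟨ cong₂ _,_ (addMod-comm 1F a) second ⟩
    (addMod a 1F , addMod (negMod b′) 0F)                    ≡⟨ sym (mulU≡ a b′ 1F 0F) ⟩
    mulU m (a , b′) (1F , 0F)                                ∎)
    where
    open ≡-Reasoning
    second = trans (cong (λ p → addMod (flip p 0F) (negMod b′)) pa≡0)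
      (trans (addMod-identityˡ (negMod b′)) (sym (addMod-identityʳ (negMod b′))))

  nonCentral-even⇒≢0F : ∀ {a b} → parityᶠ a ≡ 0ℙ → ¬ Central m (a , b) → b ≢ 0F
  nonCentral-even⇒≢0F pa≡0 noncentral refl = noncentral (central-even pa≡0)

  conj-nonCentral : ∀ {g h} → proj₁ g ≡ proj₁ h → ¬ Central m g → ¬ Central m h → Conj m g h
  conj-nonCentral {a , b} {.a , b′} refl nc nc′ with parityᶠ a in pa
  ... | 0ℙ = conj-even pa (nonCentral-even⇒≢0F pa nc) (nonCentral-even⇒≢0F pa nc′)
  ... | 1ℙ = conj-odd a b b′ pa

module NCCCGraph (k : ℕ) {n : ℕ} (reps : Fin n → U (suc (suc k))) (enum : IsClassEnumeration (suc (suc k)) n reps) where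
  open import Data.Fin.Patterns using (0F; 1F)
  open import Data.Fin.Permutation using (Permutation; permutation; ↔⇒≡)
  open import Data.Parity.Base using (Parity; 0ℙ; 1ℙ)
  open import Data.Parity.Properties using (_≟_)
  open import Data.Product using (_,_; proj₁; proj₂)
  open import Relation.Nullary using (¬_; yes; no)
  open import Relation.Binary.PropositionalEquality
  open import Data.Rational using (1ℚ)
  open FinSum using (sumFin-permute)
  open CompleteBipartite using (cross; cross-≡; cross-≢; completeBipartite; countOpposite; countOpposite-parity)
  open GroupU k

  nonCentral : ∀ i → ¬ Central m (reps i)
  nonCentral = proj₁ enum

  exponent : Fin n → Fin (2 ℕ.* m)
  exponent i = proj₁ (reps i)

  side : Fin n → Parity
  side i = parityᶠ (exponent i)

  -- the class of (a , 1), which is never central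
  classOf : Fin (2 ℕ.* m) → Fin n
  classOf a = proj₁ (proj₁ (proj₂ enum) (a , 1F) (nonCentral-a1 a))

  exponent-classOf : ∀ a → exponent (classOf a) ≡ a
  exponent-classOf a = sym (conj-fst (a , 1F) (reps (classOf a)) (proj₂ (proj₁ (proj₂ enum) (a , 1F) (nonCentral-a1 a))))

  exponent-injective : ∀ {i j} → exponent i ≡ exponent j → i ≡ j
  exponent-injective {i} {j} eq = proj₂ (proj₂ enum) i j (conj-nonCentral eq (nonCentral i) (nonCentral j))

  classOf-exponent : ∀ i → classOf (exponent i) ≡ i
  classOf-exponent i = exponent-injective (exponent-classOf (exponent i))

  classes : Permutation n (2 ℕ.* m)
  classes = permutation exponent classOf exponent-classOf classOf-exponent

  side-size : ∀ p → countOpposite p side ≡ ℕ→ℚ m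
  side-size p = trans (sym (sumFin-permute classes (λ a → cross 1ℚ p (parityᶠ a)))) (countOpposite-parity m p)

  sameSide⇒nonAdjacent : ∀ i j → side i ≡ side j → ¬ NCCCAdj m n reps i j
  sameSide⇒nonAdjacent i j same (_ , noCommute) with side i in si
  ... | 0ℙ = noCommute (reps i) (reps j) (conj-refl (reps i)) (conj-refl (reps j))
               (commute-even (exponent i) (proj₂ (reps i)) (exponent j) (proj₂ (reps j)) si (sym same))
  ... | 1ℙ = noCommute (exponent i , 0F) (exponent j , 0F)
               (conj-odd (exponent i) 0F (proj₂ (reps i)) si) (conj-odd (exponent j) 0F (proj₂ (reps j)) (sym same))
               (commute-x (exponent i) (exponent j))

  -- an even element commuting with an odd one is central, and so is its class
  evenOdd-noCommute : ∀ {i j g h} → Conj m g (reps i) → Conj m h (reps j) → side i ≡ 0ℙ → side j ≡ 1ℙ → ¬ Commute g h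
  evenOdd-noCommute {i} {j} {a , b} {c , d} g∼i h∼j si≡0 sj≡1 comm =
    nonCentral i (subst (Central m) (conj-central (a , b) (reps i) central-g g∼i) central-g)
    where
    pa≡0 : parityᶠ a ≡ 0ℙ
    pa≡0 = trans (cong parityᶠ (conj-fst (a , b) (reps i) g∼i)) si≡0
    pc≡1 : parityᶠ c ≡ 1ℙ
    pc≡1 = trans (cong parityᶠ (conj-fst (c , d) (reps j) h∼j)) sj≡1
    central-g : Central m (a , b)
    central-g = subst (λ b → Central m (a , b)) (sym (commute-even-odd a b c d pa≡0 pc≡1 comm)) (central-even pa≡0)

  differentSide⇒adjacent : ∀ i j → side i ≢ side j → NCCCAdj m n reps i j
  differentSide⇒adjacent i j differ = (λ { refl → differ refl }) , noCommute
    where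
    noCommute : ∀ g h → Conj m g (reps i) → Conj m h (reps j) → ¬ Commute g h
    noCommute g h g∼i h∼j comm with side i in si | side j in sj
    ... | 0ℙ | 1ℙ = evenOdd-noCommute g∼i h∼j si sj comm
    ... | 1ℙ | 0ℙ = evenOdd-noCommute h∼j g∼i sj si (sym comm)
    ... | 0ℙ | 0ℙ = differ refl
    ... | 1ℙ | 1ℙ = differ refl

  vertexCount : n ≡ 2 ℕ.* m
  vertexCount = ↔⇒≡ classes

  adjacency≡completeBipartite : ∀ {A} → IsAdjacencyMatrix (NCCCAdj m n reps) A →
    ∀ i j → A i j ≡ completeBipartite side i j
  adjacency≡completeBipartite isAdj i j with side i ≟ side j
  ... | yes same  = trans (proj₂ (isAdj i j) (sameSide⇒nonAdjacent i j same)) (sym (cross-≡ 1ℚ same))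
  ... | no differ = trans (proj₁ (isAdj i j) (differentSide⇒adjacent i j differ)) (sym (cross-≢ 1ℚ differ))

module BalancedCompleteBipartite (k : ℕ) (side : Fin (2 ℕ.* suc (suc k)) → Parity)
  (side-size : ∀ p → CompleteBipartite.countOpposite p side ≡ ℕ→ℚ (suc (suc k)))
  (A : Matrix (2 ℕ.* suc (suc k))) (A≡K : ∀ i j → A i j ≡ CompleteBipartite.completeBipartite side i j) where
  open import Data.Nat using (_∸_)
  import Data.Integer as ℤ
  import Data.Nat.Properties as ℕ
  open import Data.Parity.Base using (0ℙ; 1ℙ)
  open import Data.List using (List; []; _∷_; _++_; replicate)
  open import Data.Rational using (ℚ; 0ℚ; 1ℚ; _+_; _*_; _-_; -_; _/_; ∣_∣; +-*-rawSemiring)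
  open import Data.Rational.Properties using (*-identityʳ; +-identityʳ; +-identityˡ; ∣-p∣≡∣p∣)
  open import Data.Rational.Solver
  open +-*-Solver
  open import Algebra.Definitions.RawSemiring +-*-rawSemiring using (_^_)
  open import Relation.Binary.PropositionalEquality
  open RationalFacts
  open FinSum
  open PolynomialFunction using (charPoly; charPoly-replicate)
  open SpectralSum
  open Determinant using (det-cong)
  open CompleteBipartite

  m : ℕ
  m = suc (suc k)

  M : ℚ
  M = ℕ→ℚ m

  N : ℕ
  N = 2 ℕ.* m ∸ 2

  ℕ→ℚ-2m : ℕ→ℚ (2 ℕ.* m) ≡ M + M
  ℕ→ℚ-2m = trans (ℕ→ℚ-+ m (m ℕ.+ 0)) (cong (λ n → M + ℕ→ℚ n) (ℕ.+-identityʳ m))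

  degree≡m : ∀ i → degree A i ≡ M
  degree≡m i = trans (sumFin-cong (A≡K i)) (side-size (side i))

  avgDegree≡m : avgDegree A ≡ M
  avgDegree≡m = begin
    sumFin (degree A) * (ℤ.+ 1 / (2 ℕ.* m))
      ≡⟨ cong (_* (ℤ.+ 1 / (2 ℕ.* m))) (trans (sumFin-cong degree≡m) (sumFin-const (2 ℕ.* m) M)) ⟩
    ℕ→ℚ (2 ℕ.* m) * M * (ℤ.+ 1 / (2 ℕ.* m))
      ≡⟨ solve 3 (λ n M i → n :* M :* i := M :* (n :* i)) refl (ℕ→ℚ (2 ℕ.* m)) M (ℤ.+ 1 / (2 ℕ.* m)) ⟩
    M * (ℕ→ℚ (2 ℕ.* m) * (ℤ.+ 1 / (2 ℕ.* m)))
      ≡⟨ cong (M *_) (ℕ→ℚ-*-1/ (2 ℕ.* m ∸ 1)) ⟩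
    M * 1ℚ
      ≡⟨ *-identityʳ M ⟩
    M ∎
    where open ≡-Reasoning

  edgeCount≡m*m : edgeCount side ≡ M * M
  edgeCount≡m*m = trans (edgeCount≡ side) (cong₂ _*_ (side-size 0ℙ) (side-size 1ℙ))

  adjacencySpectrum laplacianSpectrum : List ℚ
  adjacencySpectrum = replicate N 0ℚ ++ (M ∷ - M ∷ [])
  laplacianSpectrum = 0ℚ ∷ replicate N M ++ (ℕ→ℚ (2 ℕ.* m) ∷ [])

  spectrum-A : HasSpectrum A adjacencySpectrum
  spectrum-A t = begin
    det (λ i j → t * δ i j - A i j)
      ≡⟨ det-cong (λ i j → cong (λ a → t * δ i j - a) (A≡K i j)) ⟩
    det (bipartite t 1ℚ side)
      ≡⟨ det-bipartite t 1ℚ side ⟩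
    t ^ N * (t * t - 1ℚ * 1ℚ * edgeCount side)
      ≡⟨ cong₂ (λ u e → u ^ N * (t * t - 1ℚ * 1ℚ * e)) (sym (+-identityʳ t)) edgeCount≡m*m ⟩
    (t - 0ℚ) ^ N * (t * t - 1ℚ * 1ℚ * (M * M))
      ≡⟨ cong ((t - 0ℚ) ^ N *_)
           (solve 2 (λ t M → t :* t :- con 1ℚ :* con 1ℚ :* (M :* M) := (t :- M) :* ((t :- (:- M)) :* con 1ℚ)) refl t M) ⟩
    (t - 0ℚ) ^ N * charPoly (M ∷ - M ∷ []) t
      ≡⟨ sym (charPoly-replicate N 0ℚ (M ∷ - M ∷ []) t) ⟩
    charPoly adjacencySpectrum t ∎
    where open ≡-Reasoning

  laplacianCharPoly : ∀ α → α * α ≡ 1ℚ → ∀ t →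
    (t - M) ^ N * ((t - M) * (t - M) - α * α * edgeCount side) ≡ charPoly laplacianSpectrum t
  laplacianCharPoly α α²≡1 t = begin
    (t - M) ^ N * ((t - M) * (t - M) - α * α * edgeCount side)
      ≡⟨ cong₂ (λ a e → (t - M) ^ N * ((t - M) * (t - M) - a * e)) α²≡1 edgeCount≡m*m ⟩
    (t - M) ^ N * ((t - M) * (t - M) - 1ℚ * (M * M))
      ≡⟨ solve 3 (λ t M p → p :* ((t :- M) :* (t :- M) :- con 1ℚ :* (M :* M)) := (t :- con 0ℚ) :* (p :* ((t :- (M :+ M)) :* con 1ℚ)))
           refl t M ((t - M) ^ N) ⟩
    (t - 0ℚ) * ((t - M) ^ N * ((t - (M + M)) * 1ℚ))
      ≡⟨ cong (λ e → (t - 0ℚ) * ((t - M) ^ N * ((t - e) * 1ℚ))) (sym ℕ→ℚ-2m) ⟩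
    (t - 0ℚ) * ((t - M) ^ N * charPoly (ℕ→ℚ (2 ℕ.* m) ∷ []) t)
      ≡⟨ cong ((t - 0ℚ) *_) (sym (charPoly-replicate N M (ℕ→ℚ (2 ℕ.* m) ∷ []) t)) ⟩
    charPoly laplacianSpectrum t ∎
    where open ≡-Reasoning

  spectrum-L : HasSpectrum (laplacian A) laplacianSpectrum
  spectrum-L t = begin
    det (λ i j → t * δ i j - laplacian A i j)
      ≡⟨ det-cong {M = λ i j → t * δ i j - laplacian A i j} entry ⟩
    det (bipartite (t - M) (- 1ℚ) side)
      ≡⟨ det-bipartite (t - M) (- 1ℚ) side ⟩
    (t - M) ^ N * ((t - M) * (t - M) - - 1ℚ * - 1ℚ * edgeCount side)
      ≡⟨ laplacianCharPoly (- 1ℚ) refl t ⟩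
    charPoly laplacianSpectrum t ∎
    where
    open ≡-Reasoning
    entry : ∀ i j → t * δ i j - laplacian A i j ≡ bipartite (t - M) (- 1ℚ) side i j
    entry i j = begin
      t * δ i j - (δ i j * degree A i - A i j)
        ≡⟨ cong₂ (λ d a → t * δ i j - (δ i j * d - a)) (degree≡m i) (A≡K i j) ⟩
      t * δ i j - (δ i j * M - c)
        ≡⟨ solve 4 (λ t d M c → t :* d :- (d :* M :- c) := (t :- M) :* d :- (:- c)) refl t (δ i j) M c ⟩
      (t - M) * δ i j - - c
        ≡⟨ cong (λ c → (t - M) * δ i j - c) (sym (cross-neg 1ℚ (side i) (side j))) ⟩
      bipartite (t - M) (- 1ℚ) side i j ∎
      where c = cross 1ℚ (side i) (side j)

  spectrum-Q : HasSpectrum (signlessLaplacian A) laplacianSpectrum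
  spectrum-Q t = begin
    det (λ i j → t * δ i j - signlessLaplacian A i j)
      ≡⟨ det-cong {M = λ i j → t * δ i j - signlessLaplacian A i j} entry ⟩
    det (bipartite (t - M) 1ℚ side)
      ≡⟨ det-bipartite (t - M) 1ℚ side ⟩
    (t - M) ^ N * ((t - M) * (t - M) - 1ℚ * 1ℚ * edgeCount side)
      ≡⟨ laplacianCharPoly 1ℚ refl t ⟩
    charPoly laplacianSpectrum t ∎
    where
    open ≡-Reasoning
    entry : ∀ i j → t * δ i j - signlessLaplacian A i j ≡ bipartite (t - M) 1ℚ side i j
    entry i j = begin
      t * δ i j - (δ i j * degree A i + A i j)
        ≡⟨ cong₂ (λ d a → t * δ i j - (δ i j * d + a)) (degree≡m i) (A≡K i j) ⟩
      t * δ i j - (δ i j * M + c)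
        ≡⟨ solve 4 (λ t d M c → t :* d :- (d :* M :+ c) := (t :- M) :* d :- c) refl t (δ i j) M c ⟩
      bipartite (t - M) 1ℚ side i j ∎
      where c = cross 1ℚ (side i) (side j)

  ∣M∣≡M : ∣ M ∣ ≡ M
  ∣M∣≡M = ∣ℕ→ℚ∣ m

  energy-A : EnergyIs A (ℕ→ℚ (2 ℕ.* m))
  energy-A = spectralSumIs {M = A} {adjacencySpectrum} 0ℚ spectrum-A (begin
    shiftedAbsSum 0ℚ adjacencySpectrum
      ≡⟨ shiftedAbsSum-replicate 0ℚ N (M ∷ - M ∷ []) ⟩
    ∣ M - 0ℚ ∣ + (∣ - M - 0ℚ ∣ + 0ℚ)
      ≡⟨ cong₂ (λ a b → ∣ a ∣ + (∣ b ∣ + 0ℚ)) (+-identityʳ M) (+-identityʳ (- M)) ⟩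
    ∣ M ∣ + (∣ - M ∣ + 0ℚ)
      ≡⟨ cong (λ b → ∣ M ∣ + (b + 0ℚ)) (∣-p∣≡∣p∣ M) ⟩
    ∣ M ∣ + (∣ M ∣ + 0ℚ)
      ≡⟨ cong (λ a → a + (a + 0ℚ)) ∣M∣≡M ⟩
    M + (M + 0ℚ)
      ≡⟨ cong (M +_) (+-identityʳ M) ⟩
    M + M
      ≡⟨ sym ℕ→ℚ-2m ⟩
    ℕ→ℚ (2 ℕ.* m) ∎)
    where open ≡-Reasoning

  laplacianEnergy-sum : shiftedAbsSum (avgDegree A) laplacianSpectrum ≡ ℕ→ℚ (2 ℕ.* m)
  laplacianEnergy-sum = begin
    shiftedAbsSum (avgDegree A) laplacianSpectrum
      ≡⟨ cong (λ c → shiftedAbsSum c laplacianSpectrum) avgDegree≡m ⟩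
    ∣ 0ℚ - M ∣ + shiftedAbsSum M (replicate N M ++ (ℕ→ℚ (2 ℕ.* m) ∷ []))
      ≡⟨ cong (∣ 0ℚ - M ∣ +_) (shiftedAbsSum-replicate M N (ℕ→ℚ (2 ℕ.* m) ∷ [])) ⟩
    ∣ 0ℚ - M ∣ + (∣ ℕ→ℚ (2 ℕ.* m) - M ∣ + 0ℚ)
      ≡⟨ cong₂ (λ a b → ∣ a ∣ + (∣ b ∣ + 0ℚ))
           (+-identityˡ (- M)) (trans (cong (_- M) ℕ→ℚ-2m) (solve 1 (λ M → (M :+ M) :- M := M) refl M)) ⟩
    ∣ - M ∣ + (∣ M ∣ + 0ℚ)
      ≡⟨ cong (λ a → a + (∣ M ∣ + 0ℚ)) (∣-p∣≡∣p∣ M) ⟩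
    ∣ M ∣ + (∣ M ∣ + 0ℚ)
      ≡⟨ cong (λ a → a + (a + 0ℚ)) ∣M∣≡M ⟩
    M + (M + 0ℚ)
      ≡⟨ cong (M +_) (+-identityʳ M) ⟩
    M + M
      ≡⟨ sym ℕ→ℚ-2m ⟩
    ℕ→ℚ (2 ℕ.* m) ∎
    where open ≡-Reasoning

  energy-L : LaplacianEnergyIs A (ℕ→ℚ (2 ℕ.* m))
  energy-L = spectralSumIs {M = laplacian A} {laplacianSpectrum} (avgDegree A) spectrum-L laplacianEnergy-sum

  energy-Q : SignlessLaplacianEnergyIs A (ℕ→ℚ (2 ℕ.* m))
  energy-Q = spectralSumIs {M = signlessLaplacian A} {laplacianSpectrum} (avgDegree A) spectrum-Q laplacianEnergy-sum

open import Data.Nat using (ℕ; _≤_; _∸_; _*_; s≤s; z≤n)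
open import Data.Product using (_×_; _,_)
open import Data.List using (_++_; _∷_; []; replicate)
open import Data.Rational using (0ℚ; -_)
open import Relation.Binary.PropositionalEquality using (refl)

corollary2p8 : (m : ℕ) → 2 ≤ m →
    (k : ℕ) (reps : Fin k → U m) → IsClassEnumeration m k reps →
    (A : Matrix k) → IsAdjacencyMatrix (NCCCAdj m k reps) A →
      HasSpectrum A (replicate (2 * m ∸ 2) 0ℚ ++ (ℕ→ℚ m ∷ - ℕ→ℚ m ∷ [])) ×
      HasSpectrum (laplacian A) (0ℚ ∷ replicate (2 * m ∸ 2) (ℕ→ℚ m) ++ (ℕ→ℚ (2 * m) ∷ [])) ×
      HasSpectrum (signlessLaplacian A) (0ℚ ∷ replicate (2 * m ∸ 2) (ℕ→ℚ m) ++ (ℕ→ℚ (2 * m) ∷ [])) ×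
      EnergyIs A (ℕ→ℚ (2 * m)) ×
      LaplacianEnergyIs A (ℕ→ℚ (2 * m)) ×
      SignlessLaplacianEnergyIs A (ℕ→ℚ (2 * m))
corollary2p8 (suc (suc m-2)) (s≤s (s≤s z≤n)) k reps enum A isAdj with NCCCGraph.vertexCount m-2 reps enum
... | refl = spectrum-A , spectrum-L , spectrum-Q , energy-A , energy-L , energy-Q
  where
  open NCCCGraph m-2 reps enum using (side; side-size; adjacency≡completeBipartite)
  open BalancedCompleteBipartite m-2 side side-size A (adjacency≡completeBipartite isAdj)
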